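{- Let $G$ be a finite simple graph with $k$ vertices, labeled $1,\dots,k$, and for $n\ge 1$ let $G_n = G \times P_n$ be the Cartesian product of $G$ with the path $P_n$ on $n$ vertices; write the vertices of $G_n$ as $(i,j)$ with $i\in[k]$, $j\in[n]$. Let $P_1, P_2,\dots,P_{B_k}$ be the set partitions of $[k]=\{1,\dots,k\}$ listed in the ordering described in the context (so $P_1=\{[k]\}$ is the one-block partition), where $B_k$ is the $k$-th Bell number. Then there exist a $B_k\times B_k$ matrix $M$ and a vector $v$ of length $B_k$, both with integer entries (and depending only on $G$), such that for all $n\ge 1$ \[ T_n = (M^n v)[1], \] where $T_n$ is the number of spanning trees of $G_n$ and $x[i]$ denotes the $i$-th entry of a vector $x$. Furthermore, for each $i$, $(M^n v)[i]$ equals the number of spanning forests of $G_n$ that are consistent with $P_i$.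
   Context: The Cartesian product $G\times H$ has vertex set $V(G)\times V(H)$, with $(a,b)$ adjacent to $(a',b')$ iff either $a=a'$ and $bb'\in E(H)$, or $b=b'$ and $aa'\in E(G)$. Ordering of partitions: for partitions $Q_1,Q_2$ of $[k]$, let $X_i$ (resp. $Y_i$) be the block of $Q_1$ (resp. $Q_2$) containing $i$, and let $j$ be the least $i$ with $X_i\ne Y_i$; then $Q_1<Q_2$ iff $|Q_1|<|Q_2|$ (fewer blocks), or $|Q_1|=|Q_2|$ and $X_j$ precedes $Y_j$ in the usual lexicographic order. For a spanning forest $\mathcal F$ of $G_n$, the partition induced by $\mathcal F$ is the partition of $[k]$ given by $i\sim j$ iff the vertices $(i,n)$ and $(j,n)$ (in the last copy of $G$) lie in the same tree of $\mathcal F$. A spanning forest $\mathcal F$ of $G_n$ is consistent with a partition $P$ of $[k]$ if $\mathcal F$ has exactly $|P|$ trees and $P$ is the partition induced by $\mathcal F$. -}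

module Defs where

open import Data.Nat using (ℕ; zero; suc; _<_; _≤_; _+_; _<ᵇ_)
open import Data.Fin using (Fin; zero; suc; toℕ; fromℕ; inject₁)
open import Data.Bool using (Bool; true; false; not; _∧_; _∨_; if_then_else_)
open import Data.Integer using (ℤ; +_) renaming (_+_ to _+ℤ_; _*_ to _*ℤ_)
open import Data.Product using (Σ; ∃; ∃-syntax; _×_; _,_)
open import Data.Sum using (_⊎_)
open import Data.List using (List; []; _∷_)
open import Relation.Binary.PropositionalEquality using (_≡_)
open import Relation.Binary.Construct.Closure.ReflexiveTransitive using (Star)
open import Relation.Nullary using (¬_)

sumFin : ∀ {n} → (Fin n → ℤ) → ℤ
sumFin {zero}  f = + 0
sumFin {suc n} f = f zero +ℤ sumFin (λ i → f (suc i))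

anyFin : ∀ {n} → (Fin n → Bool) → Bool
anyFin {zero}  f = false
anyFin {suc n} f = f zero ∨ anyFin (λ i → f (suc i))

countFin : ∀ {n} → (Fin n → Bool) → ℕ
countFin {zero}  f = 0
countFin {suc n} f = (if f zero then 1 else 0) + countFin (λ i → f (suc i))

listFin : ∀ {n} → (Fin n → Bool) → List ℕ
listFin {zero}  f = []
listFin {suc n} f =
  if f zero then 0 ∷ shift (listFin (λ i → f (suc i))) else shift (listFin (λ i → f (suc i)))
  where
  shift : List ℕ → List ℕ
  shift []       = []
  shift (x ∷ xs) = suc x ∷ shift xs

mulVec : ∀ {B} → (Fin B → Fin B → ℤ) → (Fin B → ℤ) → (Fin B → ℤ)
mulVec M x i = sumFin (λ j → M i j *ℤ x j)

powVec : ∀ {B} → (Fin B → Fin B → ℤ) → ℕ → (Fin B → ℤ) → (Fin B → ℤ)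
powVec M zero    x = x
powVec M (suc n) x = mulVec M (powVec M n x)

-- Counting: "the number of x : A with P x is N", up to an equivalence _≈_

record Count {A : Set} (_≈_ : A → A → Set) (P : A → Set) (N : ℕ) : Set where
  field
    elems    : Fin N → A
    sound    : ∀ i → P (elems i)
    distinct : ∀ i j → elems i ≈ elems j → i ≡ j
    complete : ∀ x → P x → ∃[ i ] (elems i ≈ x)

-- Finite simple graphs on vertex set Fin k (labels 1..k ↦ 0..k-1)

record SimpleGraph (k : ℕ) : Set where
  field
    adj    : Fin k → Fin k → Bool
    sym    : ∀ i j → adj i j ≡ adj j i
    irrefl : ∀ i → adj i i ≡ false

PathAdj : ∀ {n} → Fin n → Fin n → Set
PathAdj b b' = (suc (toℕ b) ≡ toℕ b') ⊎ (suc (toℕ b') ≡ toℕ b)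

Vtx : ℕ → ℕ → Set
Vtx k n = Fin k × Fin n

ProdAdj : ∀ {k} → SimpleGraph k → (n : ℕ) → Vtx k n → Vtx k n → Set
ProdAdj G n (a , b) (a' , b') =
  (a ≡ a' × PathAdj b b') ⊎ (b ≡ b' × SimpleGraph.adj G a a' ≡ true)

-- a set of edges of G_n, given by its (symmetric) characteristic function
EdgeSet : ℕ → ℕ → Set
EdgeSet k n = Vtx k n → Vtx k n → Bool

_≈E_ : ∀ {k n} → EdgeSet k n → EdgeSet k n → Set
S ≈E T = ∀ u v → S u v ≡ T u v

IsEdgeSubset : ∀ {k} → SimpleGraph k → (n : ℕ) → EdgeSet k n → Set
IsEdgeSubset G n S = (∀ u v → S u v ≡ true → ProdAdj G n u v) × (∀ u v → S u v ≡ S v u)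

Edge : ∀ {k n} → EdgeSet k n → Vtx k n → Vtx k n → Set
Edge S u v = S u v ≡ true

Reach : ∀ {k n} → EdgeSet k n → Vtx k n → Vtx k n → Set
Reach S = Star (Edge S)

-- a cycle: distinct vertices f 0, …, f (m+2) (length ≥ 3), consecutive ones
-- joined by edges of S, and the last joined to the first
HasCycle : ∀ {k n} → EdgeSet k n → Set
HasCycle {k} {n} S =
  ∃[ m ] Σ (Fin (3 + m) → Vtx k n) λ f →
    (∀ i j → f i ≡ f j → i ≡ j) ×
    (∀ (i : Fin (2 + m)) → Edge S (f (inject₁ i)) (f (suc i))) ×
    Edge S (f (fromℕ (2 + m))) (f zero)

IsSpanningForest : ∀ {k} → SimpleGraph k → (n : ℕ) → EdgeSet k n → Set
IsSpanningForest G n S = IsEdgeSubset G n S × ¬ HasCycle S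

IsSpanningTree : ∀ {k} → SimpleGraph k → (n : ℕ) → EdgeSet k n → Set
IsSpanningTree G n S = IsSpanningForest G n S × (∀ u v → Reach S u v)

NumComponents : ∀ {k n} → EdgeSet k n → ℕ → Set
NumComponents {k} {n} S c =
  Σ (Fin c → Vtx k n) λ r →
    (∀ i j → Reach S (r i) (r j) → i ≡ j) × (∀ v → ∃[ i ] Reach S (r i) v)

-- Set partitions of [k] = Fin k, as (Boolean) equivalence relations

Part : ℕ → Set
Part k = Fin k → Fin k → Bool

_≈P_ : ∀ {k} → Part k → Part k → Set
P ≈P Q = ∀ i j → P i j ≡ Q i j

IsPartition : ∀ {k} → Part k → Set
IsPartition P =
  (∀ i → P i i ≡ true) ×
  (∀ i j → P i j ≡ true → P j i ≡ true) ×
  (∀ i j l → P i j ≡ true → P j l ≡ true → P i l ≡ true)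

-- number of blocks |P| = number of i that are the least element of their block
nblocks : ∀ {k} → Part k → ℕ
nblocks P = countFin (λ i → not (anyFin (λ j → (toℕ j <ᵇ toℕ i) ∧ P i j)))

block : ∀ {k} → Part k → Fin k → List ℕ
block P i = listFin (P i)

data LexLt : List ℕ → List ℕ → Set where
  nil<cons : ∀ {y ys} → LexLt [] (y ∷ ys)
  head<    : ∀ {x y xs ys} → x < y → LexLt (x ∷ xs) (y ∷ ys)
  tail<    : ∀ {x xs ys} → LexLt xs ys → LexLt (x ∷ xs) (x ∷ ys)

PartLt : ∀ {k} → Part k → Part k → Set
PartLt {k} Q₁ Q₂ =
  nblocks Q₁ < nblocks Q₂ ⊎
  (nblocks Q₁ ≡ nblocks Q₂ ×
   ∃[ j ] ((∀ (i : Fin k) → toℕ i < toℕ j → ∀ l → Q₁ i l ≡ Q₂ i l) ×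
           ¬ (∀ l → Q₁ j l ≡ Q₂ j l) ×
           LexLt (block Q₁ j) (block Q₂ j)))

IsOrderedEnumeration : ∀ {k B} → (Fin B → Part k) → Set
IsOrderedEnumeration {k} ps =
  (∀ i → IsPartition (ps i)) ×
  (∀ i j → ps i ≈P ps j → i ≡ j) ×
  (∀ (P : Part k) → IsPartition P → ∃[ i ] (P ≈P ps i)) ×
  (∀ i j → toℕ i < toℕ j → PartLt (ps i) (ps j))

-- Spanning forests of G_n consistent with a partition P of [k]
-- (here n = suc m, and the last copy of G is the column fromℕ m)

ConsistentWith : ∀ {k} → SimpleGraph k → (m : ℕ) → Part k → EdgeSet k (suc m) → Set
ConsistentWith G m P S =
  IsSpanningForest G (suc m) S ×
  NumComponents S (nblocks P) ×
  (∀ i j → (Reach S (i , fromℕ m) (j , fromℕ m) → P i j ≡ true) ×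
           (P i j ≡ true → Reach S (i , fromℕ m) (j , fromℕ m)))

-- Cutting a spanning forest of G_{n+1} along the edges between its last two columns
-- leaves a spanning forest F of G_n together with the set e of edges it uses in the
-- two-column gadget K = G × P_2 (rungs into the new column and edges inside it).  For
-- gluing, F only matters through the partition Q it induces on its last column: F may be
-- replaced by the graph D Q e on K whose old column carries a clique on each block of Q.
-- Call e valid for (Q , P) when no edge of e lies on a cycle of D Q e, every old vertex
-- reaches the new column, and the new column is partitioned as P.  Gluing is then a bijection
--   forests of G_{n+1} consistent with P  ≅  Σ_Q (forests of G_n consistent with Q) × (e valid for (Q , P)),
-- so c_{n+1}(P) = Σ_Q M[P][Q] c_n(Q), where M[P][Q] is the (finite, since validity is
-- decidable) number of valid e.  The base case G_1 is the same gadget over the discrete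
-- partition, so c_n = M^n v with v the indicator of the discrete partition.  Spanning trees
-- are the forests consistent with the one-block partition, which comes first in the order.

module Submission where

open import Defs
open import Data.Nat as ℕ using (ℕ; zero; suc; _+_; _*_; _≤_; _<_; z≤n; s≤s; _<ᵇ_)
import Data.Nat.Properties as ℕP
open import Data.Fin as F using (Fin; zero; suc; toℕ; fromℕ; inject₁)
import Data.Fin.Properties as FP
open import Data.Integer using (ℤ; +_) renaming (_+_ to _+ℤ_; _*_ to _*ℤ_)
import Data.Integer.Properties as ℤP
open import Data.List as L using (List; []; _∷_; length; lookup)
open import Data.List.Relation.Unary.All as All using (All; []; _∷_)
open import Data.List.Relation.Unary.All.Properties using (¬Any⇒All¬)
open import Data.List.Relation.Unary.Any as Any using (Any; here; there)
open import Data.List.Relation.Unary.AllPairs using ([]; _∷_)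
open import Data.List.Relation.Unary.Unique.Propositional using (Unique)
open import Data.List.Membership.Propositional using (_∈_)
open import Data.List.Membership.Propositional.Properties using (∈-lookup; ∈-cartesianProduct⁺; ∈-allFin)
open import Data.Product using (Σ; ∃; ∃-syntax; _×_; _,_; proj₁; proj₂)
open import Data.Product.Properties using (≡-dec)
open import Data.Maybe using (Maybe; just; nothing)
open import Data.Sum using (_⊎_; inj₁; inj₂)
open import Data.Empty using (⊥; ⊥-elim)
open import Data.Unit using (⊤; tt)
open import Data.Bool using (Bool; true; false; not; _∧_; _∨_; if_then_else_; T)
import Data.Bool.Properties as BP
open import Relation.Binary.Structures using (IsEquivalence)
open import Relation.Nullary using (¬_; Dec; yes; no; does)
open import Relation.Nullary.Decidable using (map′; _×-dec_; _⊎-dec_; _→-dec_; ¬?)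
open import Relation.Binary.Definitions using (DecidableEquality; tri<; tri≈; tri>)
open import Relation.Binary.PropositionalEquality
  using (_≡_; refl; sym; trans; cong; cong₂; subst; subst₂; module ≡-Reasoning) renaming (isEquivalence to ≡-equiv)
open import Relation.Binary.Construct.Closure.ReflexiveTransitive as Star
  using (Star; ε; _◅_; _◅◅_; kleisliStar)

-- Walks, cycles and reachability in a graph on an arbitrary vertex type with decidable
-- equality.  A graph is a Boolean adjacency function T; Star gives walks.

module Walks {V : Set} (_≟_ : DecidableEquality V) where

  data Path (R : V → V → Set) : V → V → List V → Set where
    stop : ∀ {x} → Path R x x (x ∷ [])
    step : ∀ {x y z vs} → R x y → Path R y z vs → Path R x z (x ∷ vs)

  module _ {R : V → V → Set} where

    pathFrom : ∀ {x y z vs} → Path R y z vs → x ∈ vs →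
      ∃ λ ws → Path R x z ws × (Unique vs → Unique ws)
    pathFrom stop (here refl) = _ , stop , λ u → u
    pathFrom (step r p) (here refl) = _ , step r p , λ u → u
    pathFrom (step r p) (there x∈) with pathFrom p x∈
    ... | ws , p' , f = ws , p' , λ { (_ ∷ u) → f u }

    simplePath : ∀ {x y} → Star R x y → ∃ λ vs → Path R x y vs × Unique vs
    simplePath ε = _ , stop , [] ∷ []
    simplePath {x} (r ◅ s) with simplePath s
    ... | vs , p , u with Any.any? (x ≟_) vs
    ... | yes x∈ = let (ws , p' , f) = pathFrom p x∈ in ws , p' , f u
    ... | no x∉ = _ , step r p , ¬Any⇒All¬ vs x∉ ∷ u

    path-steps : ∀ {x y v vs} → Path R x y (v ∷ vs) → ∀ (i : Fin (length vs)) →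
      R (lookup (v ∷ vs) (inject₁ i)) (lookup (v ∷ vs) (suc i))
    path-steps (step r stop) zero = r
    path-steps (step r (step _ _)) zero = r
    path-steps (step r (step r' p)) (suc i) = path-steps (step r' p) i

    path-last : ∀ {x y v vs} → Path R x y (v ∷ vs) → lookup (v ∷ vs) (fromℕ (length vs)) ≡ y
    path-last stop = refl
    path-last (step r stop) = refl
    path-last (step r (step r' p)) = path-last (step r' p)

  lookup-injective : ∀ {vs : List V} → Unique vs → ∀ i j → lookup vs i ≡ lookup vs j → i ≡ j
  lookup-injective (_ ∷ _) zero zero _ = refl
  lookup-injective (x∉ ∷ _) zero (suc j) eq = ⊥-elim (All.lookup x∉ (∈-lookup j) eq)
  lookup-injective (x∉ ∷ _) (suc i) zero eq = ⊥-elim (All.lookup x∉ (∈-lookup i) (sym eq))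
  lookup-injective (_ ∷ u) (suc i) (suc j) eq = cong suc (lookup-injective u i j eq)

  unique-length≤ : ∀ {N} (enc : V → Fin N) → (∀ u v → enc u ≡ enc v → u ≡ v) →
    ∀ {vs} → Unique vs → length vs ≤ N
  unique-length≤ {N} enc enc-inj {vs} u with length vs ℕ.≤? N
  ... | yes le = le
  ... | no gt with FP.pigeonhole (ℕP.≰⇒> gt) (λ i → enc (lookup vs i))
  ... | i , j , i<j , eq =
    ⊥-elim (ℕP.<⇒≢ i<j (cong toℕ (lookup-injective u i j (enc-inj _ _ eq))))

  Ed : (T : V → V → Bool) → V → V → Set
  Ed T u v = T u v ≡ true

  Without : (T : V → V → Bool) → V → V → V → V → Set
  Without T a b u v = T u v ≡ true × ¬ (u ≡ a × v ≡ b) × ¬ (u ≡ b × v ≡ a)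

  Acyclic : (V → V → Bool) → Set
  Acyclic T = ∀ a b → T a b ≡ true → ¬ Star (Without T a b) b a

  HasCycleOn : (V → V → Bool) → Set
  HasCycleOn S =
    ∃[ m ] Σ (Fin (3 + m) → V) λ f →
      (∀ i j → f i ≡ f j → i ≡ j) ×
      (∀ (i : Fin (2 + m)) → Ed S (f (inject₁ i)) (f (suc i))) ×
      Ed S (f (fromℕ (2 + m))) (f zero)

  walkAlong : ∀ {R : V → V → Set} n (f : Fin (suc n) → V) →
    (∀ i → R (f (inject₁ i)) (f (suc i))) → Star R (f zero) (f (fromℕ n))
  walkAlong zero f steps = ε
  walkAlong (suc n) f steps = steps zero ◅ walkAlong n (λ i → f (suc i)) (λ i → steps (suc i))

  -- the closing edge of a cycle is bypassed by the rest of the cycle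
  acyclic⇒noCycle : ∀ {T} → Acyclic T → ¬ HasCycleOn T
  acyclic⇒noCycle {T} ac (m , f , inj , steps , close) =
    ac (f (fromℕ (2 + m))) (f zero) close (walkAlong (2 + m) f avoids)
    where
    notLast : ∀ (i : Fin (2 + m)) → ¬ inject₁ i ≡ fromℕ (2 + m)
    notLast i eq = FP.fromℕ≢inject₁ (sym eq)
    notBoth : ∀ (i : Fin (2 + m)) → inject₁ i ≡ zero → suc i ≡ fromℕ (2 + m) → ⊥
    notBoth i i≡0 i+1≡last with ℕP.suc-injective (trans (cong toℕ i+1≡last) (FP.toℕ-fromℕ _))
    ... | i≡m+1 = ℕP.0≢1+n (trans (sym (trans (sym (FP.toℕ-inject₁ i)) (cong toℕ i≡0))) i≡m+1)
    avoids : ∀ i → Without T (f (fromℕ (2 + m))) (f zero) (f (inject₁ i)) (f (suc i))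
    avoids i = steps i , (λ (e , _) → notLast i (inj _ _ e))
                       , (λ (e₁ , e₂) → notBoth i (inj _ _ e₁) (inj _ _ e₂))

  closeCycle : ∀ {T a b v₁ v₂ rest} → T a b ≡ true →
    Path (Without T a b) b a (b ∷ v₁ ∷ v₂ ∷ rest) → Unique (b ∷ v₁ ∷ v₂ ∷ rest) → HasCycleOn T
  closeCycle {T} {a} {b} {v₁} {v₂} {rest} ab p u =
    length rest , lookup (b ∷ v₁ ∷ v₂ ∷ rest) , lookup-injective u ,
    (λ i → proj₁ (path-steps p i)) , subst (λ z → T z b ≡ true) (sym (path-last p)) ab

  -- conversely a bypassing walk can be shortened to a simple one, which closes a cycle
  noCycle⇒acyclic : ∀ {T} → (∀ u → T u u ≡ false) → ¬ HasCycleOn T → Acyclic T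
  noCycle⇒acyclic {T} irr nc a b ab s with simplePath s
  ... | _ , stop , _ with () ← trans (sym ab) (irr a)
  ... | _ , step r stop , _ = proj₂ (proj₂ r) (refl , refl)
  ... | _ , p@(step _ (step _ stop)) , u = nc (closeCycle ab p u)
  ... | _ , p@(step _ (step _ (step _ _))) , u = nc (closeCycle ab p u)

  -- Reachability along a decidable relation on a finite, listable vertex type is
  -- decidable: a walk may be assumed simple, hence of length at most N.
  module Reachability (allV : List V) (allV-complete : ∀ v → v ∈ allV) (N : ℕ) (enc : V → Fin N)
                      (enc-inj : ∀ u v → enc u ≡ enc v → u ≡ v) where

    ReachIn : (R : V → V → Set) → ℕ → V → V → Set
    ReachIn R zero u y = u ≡ y
    ReachIn R (suc t) u y = u ≡ y ⊎ Any (λ v → R u v × ReachIn R t v y) allV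

    reachIn? : ∀ {R} → (∀ u v → Dec (R u v)) → ∀ t u y → Dec (ReachIn R t u y)
    reachIn? R? zero u y = u ≟ y
    reachIn? R? (suc t) u y with u ≟ y
    ... | yes u≡y = yes (inj₁ u≡y)
    ... | no u≢y = map′ inj₂ (λ { (inj₁ u≡y) → ⊥-elim (u≢y u≡y) ; (inj₂ q) → q })
                        (Any.any? (λ v → R? u v ×-dec reachIn? R? t v y) allV)

    reachIn-sound : ∀ {R} t {u y} → ReachIn R t u y → Star R u y
    reachIn-sound zero refl = ε
    reachIn-sound (suc t) (inj₁ refl) = ε
    reachIn-sound (suc t) (inj₂ q) with Any.satisfied q
    ... | v , r , rest = r ◅ reachIn-sound t rest

    reachIn-complete : ∀ {R} t {u y vs} → Path R u y vs → length vs ≤ suc t → ReachIn R t u y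
    reachIn-complete zero stop _ = refl
    reachIn-complete (suc t) stop _ = inj₁ refl
    reachIn-complete zero (step r stop) (s≤s ())
    reachIn-complete zero (step r (step _ _)) (s≤s ())
    reachIn-complete (suc t) (step {y = v} r p) (s≤s le) =
      inj₂ (Any.map (λ { refl → r , reachIn-complete t p le }) (allV-complete v))

    star? : ∀ {R} → (∀ u v → Dec (R u v)) → ∀ u y → Dec (Star R u y)
    star? R? u y = map′ (reachIn-sound N) complete (reachIn? R? N u y)
      where
      complete : Star _ u y → ReachIn _ N u y
      complete s = let (vs , p , uniq) = simplePath s in
        reachIn-complete N p (ℕP.≤-trans (unique-length≤ enc enc-inj uniq) (ℕP.n≤1+n N))

  steps : ∀ {R : V → V → Set} {x y} → Star R x y → ℕ
  steps ε = 0
  steps (_ ◅ s) = suc (steps s)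

  steps-◅◅ : ∀ {R : V → V → Set} {x y z} (s : Star R x y) (t : Star R y z) →
    steps (s ◅◅ t) ≡ steps s + steps t
  steps-◅◅ ε t = refl
  steps-◅◅ (_ ◅ s) t = cong suc (steps-◅◅ s t)

  steps-map : ∀ {R R' : V → V → Set} (f : ∀ {x y} → R x y → R' x y) {x y} (s : Star R x y) →
    steps (Star.map f s) ≡ steps s
  steps-map f ε = refl
  steps-map f (_ ◅ s) = cong suc (steps-map f s)

  _∖_ : (R Pr : V → V → Set) → V → V → Set
  (R ∖ Pr) u v = R u v × ¬ Pr u v

  splitFirst : ∀ {R Pr : V → V → Set} → (∀ u v → Dec (Pr u v)) → ∀ {x y} (s : Star R x y) →
    Star (R ∖ Pr) x y ⊎
    (∃ λ u → ∃ λ v → Σ (Star (R ∖ Pr) x u) λ s₁ → R u v × Pr u v ×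
       Σ (Star R v y) λ s₂ → steps s ≡ steps s₁ + suc (steps s₂))
  splitFirst Pr? ε = inj₁ ε
  splitFirst Pr? {x} (_◅_ {j = z} r s) with Pr? x z
  ... | yes p = inj₂ (x , z , ε , r , p , s , refl)
  ... | no ¬p with splitFirst Pr? s
  ... | inj₁ t = inj₁ ((r , ¬p) ◅ t)
  ... | inj₂ (u , v , s₁ , r' , p , s₂ , eq) = inj₂ (u , v , (r , ¬p) ◅ s₁ , r' , p , s₂ , cong suc eq)

  -- Let some edges of T be "special" (a decidable symmetric predicate).  If a non-special
  -- edge ab lies on a cycle, then it lies on a cycle without special edges, or some special
  -- edge lies on a cycle.  (Shortcut the cycle at the first special edge cd: if the rest
  -- of the walk avoids cd we get a cycle through cd; otherwise it contains a shorter walk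
  -- from b to a, and we recurse on its length.)
  module CycleExchange (T : V → V → Bool) {Sp : V → V → Set} (Sp? : ∀ u v → Dec (Sp u v))
                       (Sp-sym : ∀ {u v} → Sp u v → Sp v u) (a b : V) (ab : T a b ≡ true)
                       (¬Sp-ab : ¬ Sp a b) where

    SameEdge : V → V → V → V → Set
    SameEdge c d u v = (u ≡ c × v ≡ d) ⊎ (u ≡ d × v ≡ c)

    sameEdge? : ∀ c d u v → Dec (SameEdge c d u v)
    sameEdge? c d u v = ((u ≟ c) ×-dec (v ≟ d)) ⊎-dec ((u ≟ d) ×-dec (v ≟ c))

    avoid : ∀ {c d u v} → (Without T a b ∖ SameEdge c d) u v → Without T c d u v
    avoid (w , ¬same) = proj₁ w , (λ e → ¬same (inj₁ e)) , (λ e → ¬same (inj₂ e))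

    CycleOutcome : Set
    CycleOutcome = Star (Without T a b ∖ Sp) b a ⊎
                   (∃ λ c → ∃ λ d → Sp c d × T c d ≡ true × Star (Without T c d) d c)

    exchange : ∀ fuel (s : Star (Without T a b) b a) → steps s ≤ fuel → CycleOutcome
    exchange fuel s le with splitFirst Sp? s
    ... | inj₁ t = inj₁ t
    ... | inj₂ (c , d , s₁ , cd , Sp-cd , s₂ , eq) with splitFirst (sameEdge? c d) s₂
    ...   | inj₁ t₂ = inj₂ (c , d , Sp-cd , proj₁ cd , Star.map avoid t₂ ◅◅ (abAvoids ◅ Star.map nonSpecial s₁))
      where
      abAvoids : Without T c d a b
      abAvoids = ab , (λ { (refl , refl) → ¬Sp-ab Sp-cd }) , (λ { (refl , refl) → ¬Sp-ab (Sp-sym Sp-cd) })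
      nonSpecial : ∀ {u v} → (Without T a b ∖ Sp) u v → Without T c d u v
      nonSpecial (w , ¬sp) = proj₁ w , (λ { (refl , refl) → ¬sp Sp-cd }) , (λ { (refl , refl) → ¬sp (Sp-sym Sp-cd) })
    ...   | inj₂ (_ , _ , s₃ , _ , inj₁ (refl , refl) , _ , _) = inj₂ (c , d , Sp-cd , proj₁ cd , Star.map avoid s₃)
    ...   | inj₂ (_ , _ , s₃ , _ , inj₂ (refl , refl) , s₄ , eq₂) with fuel
    ...     | zero with () ← ℕP.n≤0⇒n≡0 (subst (_≤ 0) (trans eq (ℕP.+-suc (steps s₁) (steps s₂))) le)
    ...     | suc fuel' = exchange fuel' (Star.map proj₁ s₁ ◅◅ s₄) shorter
      where
      -- the new walk omits the steps cd and dc
      shorter : steps (Star.map proj₁ s₁ ◅◅ s₄) ≤ fuel'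
      shorter = ℕP.≤-pred (begin
        suc (steps (Star.map proj₁ s₁ ◅◅ s₄))   ≡⟨ cong suc (trans (steps-◅◅ (Star.map proj₁ s₁) s₄)
                                                      (cong (_+ steps s₄) (steps-map proj₁ s₁))) ⟩
        suc (steps s₁ + steps s₄)             ≤⟨ s≤s (ℕP.+-monoʳ-≤ (steps s₁)
                                                      (ℕP.≤-trans (ℕP.m≤n+m (steps s₄) (suc (steps s₃)))
                                                        (ℕP.≤-reflexive (sym (trans eq₂ (ℕP.+-suc _ _)))))) ⟩
        suc (steps s₁ + steps s₂)             ≡⟨ sym (ℕP.+-suc (steps s₁) (steps s₂)) ⟩
        steps s₁ + suc (steps s₂)             ≡⟨ sym eq ⟩
        steps s                               ≤⟨ le ⟩
        suc fuel'                             ∎)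
        where open ℕP.≤-Reasoning

module Counting where

  open Count

  sumℕ : ∀ {B} → (Fin B → ℕ) → ℕ
  sumℕ {zero} f = 0
  sumℕ {suc B} f = f zero + sumℕ (λ i → f (suc i))

  zero≢suc : ∀ {n} {i : Fin n} → ¬ (zero ≡ suc i)
  zero≢suc ()

  count-cong : ∀ {A : Set} {_≈_ : A → A → Set} {P P' : A → Set} {n} → Count _≈_ P n →
    (∀ x → P x → P' x) → (∀ x → P' x → P x) → Count _≈_ P' n
  count-cong c to from = record
    { elems = elems c ; sound = λ i → to _ (sound c i) ; distinct = distinct c
    ; complete = λ x p → complete c x (from x p) }

  count-none : ∀ {A : Set} {_≈_ : A → A → Set} {P : A → Set} → (∀ x → ¬ P x) → Count _≈_ P 0
  count-none ¬P = record
    { elems = λ () ; sound = λ () ; distinct = λ () ; complete = λ x p → ⊥-elim (¬P x p) }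

  module _ {A : Set} {_≈_ : A → A → Set} (≈-equiv : IsEquivalence _≈_) where
    open IsEquivalence ≈-equiv renaming (refl to ≈-refl; sym to ≈-sym; trans to ≈-trans)

    count-⊎ : ∀ {P Q : A → Set} {a b} → Count _≈_ P a → Count _≈_ Q b →
      (∀ x y → P x → Q y → ¬ x ≈ y) → Count _≈_ (λ x → P x ⊎ Q x) (a + b)
    count-⊎ {P} {Q} {a} {b} cP cQ disjoint =
      record { elems = el ; sound = so ; distinct = di ; complete = co }
      where
      el' : Fin a ⊎ Fin b → A
      el' (inj₁ i) = elems cP i
      el' (inj₂ i) = elems cQ i
      el : Fin (a + b) → A
      el i = el' (F.splitAt a i)
      so : ∀ i → P (el i) ⊎ Q (el i)
      so i with F.splitAt a i
      ... | inj₁ x = inj₁ (sound cP x)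
      ... | inj₂ y = inj₂ (sound cQ y)
      di' : ∀ s t → el' s ≈ el' t → s ≡ t
      di' (inj₁ x) (inj₁ y) e = cong inj₁ (distinct cP x y e)
      di' (inj₂ x) (inj₂ y) e = cong inj₂ (distinct cQ x y e)
      di' (inj₁ x) (inj₂ y) e = ⊥-elim (disjoint _ _ (sound cP x) (sound cQ y) e)
      di' (inj₂ x) (inj₁ y) e = ⊥-elim (disjoint _ _ (sound cP y) (sound cQ x) (≈-sym e))
      di : ∀ i j → el i ≈ el j → i ≡ j
      di i j e = trans (sym (FP.join-splitAt a b i))
        (trans (cong (F.join a b) (di' (F.splitAt a i) (F.splitAt a j) e)) (FP.join-splitAt a b j))
      co : ∀ x → P x ⊎ Q x → ∃ λ i → el i ≈ x
      co x (inj₁ p) with complete cP x p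
      ... | i , e = i F.↑ˡ b , subst (λ s → el' s ≈ x) (sym (FP.splitAt-↑ˡ a i b)) e
      co x (inj₂ q) with complete cQ x q
      ... | i , e = a F.↑ʳ i , subst (λ s → el' s ≈ x) (sym (FP.splitAt-↑ʳ a b i)) e

    count-∃ : ∀ {B} {P : Fin B → A → Set} {n : Fin B → ℕ} → (∀ i → Count _≈_ (P i) (n i)) →
      (∀ i j x y → P i x → P j y → x ≈ y → i ≡ j) → Count _≈_ (λ x → ∃ λ i → P i x) (sumℕ n)
    count-∃ {zero} c disjoint = count-none λ { x (() , _) }
    count-∃ {suc B} {P} c disjoint =
      count-cong (count-⊎ (c zero) rest λ { x y p (i , q) e → zero≢suc (disjoint zero (suc i) x y p q e) })
        (λ { x (inj₁ p) → zero , p ; x (inj₂ (i , p)) → suc i , p })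
        (λ { x (zero , p) → inj₁ p ; x (suc i , p) → inj₂ (i , p) })
      where
      rest : Count _≈_ (λ x → ∃ λ i → P (suc i) x) _
      rest = count-∃ (λ i → c (suc i)) (λ i j x y p q e → FP.suc-injective (disjoint (suc i) (suc j) x y p q e))

    filter-list : ∀ {n} (e : Fin n → A) → (∀ i j → e i ≈ e j → i ≡ j) → {Q : A → Set} →
      (∀ x → Dec (Q x)) → (∀ x y → x ≈ y → Q x → Q y) →
      ∃ λ m → Count _≈_ (λ x → (∃ λ i → e i ≈ x) × Q x) m
    filter-list {zero} e inj Q? resp = 0 , count-none λ { x ((() , _) , _) }
    filter-list {suc n} e inj {Q} Q? resp with filter-list (λ i → e (suc i)) (λ i j h → FP.suc-injective (inj _ _ h)) Q? resp | Q? (e zero)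
    ... | m , c | yes q = suc m , count-cong (count-⊎ first c apart)
          (λ { x (inj₁ (h , qx)) → (zero , h) , qx ; x (inj₂ ((i , h) , qx)) → (suc i , h) , qx })
          (λ { x ((zero , h) , qx) → inj₁ (h , qx) ; x ((suc i , h) , qx) → inj₂ ((i , h) , qx) })
      where
      first : Count _≈_ (λ x → e zero ≈ x × Q x) 1
      first = record { elems = λ _ → e zero ; sound = λ _ → ≈-refl , q
                     ; distinct = λ { zero zero _ → refl } ; complete = λ x p → zero , proj₁ p }
      apart : ∀ x y → e zero ≈ x × Q x → (∃ λ i → e (suc i) ≈ y) × Q y → ¬ x ≈ y
      apart x y (h , _) ((i , h') , _) x≈y = zero≢suc (inj _ _ (≈-trans h (≈-trans x≈y (≈-sym h'))))
    ... | m , c | no ¬q = m , count-cong c (λ { x ((i , h) , qx) → (suc i , h) , qx })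
          (λ { x ((zero , h) , qx) → ⊥-elim (¬q (resp _ _ (≈-sym h) qx)) ; x ((suc i , h) , qx) → (i , h) , qx })

    count-filter : ∀ {P Q : A → Set} {n} → Count _≈_ P n → (∀ x → Dec (Q x)) →
      (∀ x y → x ≈ y → P x → P y) → (∀ x y → x ≈ y → Q x → Q y) → ∃ λ m → Count _≈_ (λ x → P x × Q x) m
    count-filter c Q? respP respQ with filter-list (elems c) (distinct c) Q? respQ
    ... | m , c' = m , count-cong c' (λ { x ((i , h) , qx) → respP _ _ h (sound c i) , qx })
                                    (λ { x (px , qx) → complete c x px , qx })

  module _ {A B : Set} {_≈A_ : A → A → Set} {_≈B_ : B → B → Set} where

    count-× : ∀ {P : A → Set} {Q : B → Set} {a b} → Count _≈A_ P a → Count _≈B_ Q b →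
      Count (λ p q → proj₁ p ≈A proj₁ q × proj₂ p ≈B proj₂ q) (λ p → P (proj₁ p) × Q (proj₂ p)) (a * b)
    count-× {P} {Q} {a} {b} cP cQ =
      record { elems = el ; sound = λ i → sound cP _ , sound cQ _ ; distinct = di ; complete = co }
      where
      el : Fin (a * b) → A × B
      el i = elems cP (proj₁ (F.remQuot {a} b i)) , elems cQ (proj₂ (F.remQuot {a} b i))
      di : ∀ i j → proj₁ (el i) ≈A proj₁ (el j) × proj₂ (el i) ≈B proj₂ (el j) → i ≡ j
      di i j (e₁ , e₂) = trans (sym (FP.combine-remQuot {a} b i))
        (trans (cong₂ F.combine (distinct cP _ _ e₁) (distinct cQ _ _ e₂)) (FP.combine-remQuot {a} b j))
      co : ∀ x → P (proj₁ x) × Q (proj₂ x) → ∃ λ i → proj₁ (el i) ≈A proj₁ x × proj₂ (el i) ≈B proj₂ x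
      co (x , y) (p , q) with complete cP x p | complete cQ y q
      ... | i , e₁ | j , e₂ = F.combine i j ,
          subst (λ r → elems cP (proj₁ r) ≈A x × elems cQ (proj₂ r) ≈B y) (sym (FP.remQuot-combine i j)) (e₁ , e₂)

    count-map : ∀ {P : A → Set} {Q : B → Set} {n} → (∀ {u v w} → u ≈B v → v ≈B w → u ≈B w) →
      Count _≈A_ P n → (f : A → B) → (∀ x y → x ≈A y → f x ≈B f y) → (∀ x → P x → Q (f x)) →
      (∀ x y → P x → P y → f x ≈B f y → x ≈A y) → (∀ z → Q z → ∃ λ x → P x × f x ≈B z) → Count _≈B_ Q n
    count-map ≈B-trans c f f-resp f-sound f-inj f-onto = record
      { elems = λ i → f (elems c i) ; sound = λ i → f-sound _ (sound c i)
      ; distinct = λ i j e → distinct c i j (f-inj _ _ (sound c i) (sound c j) e)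
      ; complete = λ z q → let (x , p , e) = f-onto z q ; (i , e') = complete c x p in
                           i , ≈B-trans (f-resp _ _ e') e }

  Pointwise : {A X : Set} → (X → X → Set) → (A → X) → (A → X) → Set
  Pointwise _≈_ f g = ∀ a → f a ≈ g a

  pointwise-equiv : ∀ {A X : Set} {_≈_ : X → X → Set} → IsEquivalence _≈_ → IsEquivalence (Pointwise {A} _≈_)
  pointwise-equiv eq = record
    { refl = λ a → refl′ ; sym = λ e a → sym′ (e a) ; trans = λ e f a → trans′ (e a) (f a) }
    where open IsEquivalence eq renaming (refl to refl′; sym to sym′; trans to trans′)

  Finite : Set → ℕ → Set
  Finite A = Count _≡_ (λ (_ : A) → ⊤)

  finite-Bool : Finite Bool 2
  finite-Bool = record { elems = el ; sound = λ _ → tt ; distinct = di ; complete = co }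
    where
    el : Fin 2 → Bool
    el zero = true
    el (suc zero) = false
    di : ∀ i j → el i ≡ el j → i ≡ j
    di zero zero _ = refl
    di (suc zero) (suc zero) _ = refl
    di zero (suc zero) ()
    di (suc zero) zero ()
    co : ∀ x → ⊤ → ∃ λ i → el i ≡ x
    co true _ = zero , refl
    co false _ = suc zero , refl

  finite-Fin : ∀ n → Finite (Fin n) n
  finite-Fin n = record { elems = λ i → i ; sound = λ _ → tt ; distinct = λ _ _ e → e ; complete = λ i _ → i , refl }

  finite-× : ∀ {A B a b} → Finite A a → Finite B b → Finite (A × B) (a * b)
  finite-× cA cB = count-map (λ { refl refl → refl }) (count-× cA cB) (λ p → p)
    (λ { _ _ (refl , refl) → refl }) (λ _ _ → tt) (λ { _ _ _ _ refl → refl , refl }) (λ z _ → z , (tt , tt) , refl)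

  module _ {X : Set} {_≈_ : X → X → Set} (≈-equiv : IsEquivalence _≈_) where
    open IsEquivalence ≈-equiv renaming (refl to ≈-refl; trans to ≈-trans)

    count-vectors : ∀ {c} → Count _≈_ (λ _ → ⊤) c → ∀ j → Count (Pointwise {Fin j} _≈_) (λ _ → ⊤) (c ℕ.^ j)
    count-vectors cX zero = record { elems = λ _ → λ () ; sound = λ _ → tt
                                   ; distinct = λ { zero zero _ → refl } ; complete = λ f _ → zero , λ () }
    count-vectors cX (suc j) = count-map (λ e₁ e₂ i → ≈-trans (e₁ i) (e₂ i)) (count-× cX (count-vectors cX j)) cons
      (λ { x y (e₁ , e₂) zero → e₁ ; x y (e₁ , e₂) (suc i) → e₂ i })
      (λ _ _ → tt)
      (λ x y _ _ h → h zero , λ i → h (suc i))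
      (λ f _ → (f zero , (λ i → f (suc i))) , (tt , tt) , λ { zero → ≈-refl ; (suc i) → ≈-refl })
      where
      cons : X × (Fin j → X) → Fin (suc j) → X
      cons (x , g) zero = x
      cons (x , g) (suc i) = g i

    -- functions on a finite type A of size a are functions on Fin a
    count-functions : ∀ {A a c} → Finite A a → Count _≈_ (λ _ → ⊤) c →
      Count (Pointwise {A} _≈_) (λ _ → ⊤) (c ℕ.^ a)
    count-functions {A} {a} cA cX = count-map (λ e₁ e₂ x → ≈-trans (e₁ x) (e₂ x)) (count-vectors cX a)
      (λ g x → g (index x)) (λ g g' e x → e (index x)) (λ _ _ → tt) inj onto
      where
      index : A → Fin a
      index x = proj₁ (Count.complete cA x tt)
      index-elems : ∀ i → index (Count.elems cA i) ≡ i
      index-elems i = Count.distinct cA _ _ (proj₂ (Count.complete cA (Count.elems cA i) tt))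
      inj : ∀ g g' → ⊤ → ⊤ → Pointwise _≈_ (λ x → g (index x)) (λ x → g' (index x)) → Pointwise _≈_ g g'
      inj g g' _ _ e i = subst (λ j → g j ≈ g' j) (index-elems i) (e (Count.elems cA i))
      onto : ∀ h → ⊤ → ∃ λ g → ⊤ × Pointwise _≈_ (λ x → g (index x)) h
      onto h _ = (λ i → h (Count.elems cA i)) , tt ,
                 λ x → subst (λ y → h (Count.elems cA (index x)) ≈ h y) (proj₂ (Count.complete cA x tt)) ≈-refl

module Vertices (k : ℕ) where

  _≟V_ : ∀ {n} → DecidableEquality (Vtx k n)
  _≟V_ = ≡-dec FP._≟_ FP._≟_

  encode : ∀ {n} → Vtx k n → Fin (k * n)
  encode (a , b) = F.combine a b

  encode-injective : ∀ {n} (u v : Vtx k n) → encode u ≡ encode v → u ≡ v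
  encode-injective (a , b) (a' , b') eq with FP.combine-injective a b a' b' eq
  ... | refl , refl = refl

  module W {n : ℕ} = Walks (_≟V_ {n})
  module R {n : ℕ} = W.Reachability {n}
    (L.cartesianProduct (L.allFin k) (L.allFin n))
    (λ (a , b) → ∈-cartesianProduct⁺ (∈-allFin a) (∈-allFin b))
    (k * n) encode encode-injective

  isTrue? : ∀ (b : Bool) → Dec (b ≡ true)
  isTrue? b = b BP.≟ true

  reach? : ∀ {n} (S : EdgeSet k n) u v → Dec (Reach S u v)
  reach? S = R.star? (λ u v → isTrue? (S u v))

  without? : ∀ {n} (T : EdgeSet k n) a b u v → Dec (W.Without T a b u v)
  without? T a b u v = isTrue? (T u v) ×-dec ¬? ((u ≟V a) ×-dec (v ≟V b)) ×-dec ¬? ((u ≟V b) ×-dec (v ≟V a))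

  reach-sym : ∀ {n} {S : EdgeSet k n} → (∀ u v → S u v ≡ S v u) → ∀ {u v} → Reach S u v → Reach S v u
  reach-sym S-sym = Star.reverse (λ {x} {y} e → trans (S-sym y x) e)

  ≈E-equiv : ∀ {n} → IsEquivalence (_≈E_ {k} {n})
  ≈E-equiv = record { refl = λ u v → refl ; sym = λ e u v → sym (e u v) ; trans = λ e f u v → trans (e u v) (f u v) }

  module ≈E {n : ℕ} = IsEquivalence (≈E-equiv {n})

  reach-resp : ∀ {n} {S S' : EdgeSet k n} → S ≈E S' → ∀ {u v} → Reach S u v → Reach S' u v
  reach-resp e = Star.map (λ {x} {y} h → trans (sym (e x y)) h)

  acyclic-resp : ∀ {n} {S S' : EdgeSet k n} → S ≈E S' → W.Acyclic S → W.Acyclic S'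
  acyclic-resp e ac a b h w =
    ac a b (trans (e a b) h) (Star.map (λ {x} {y} (p , q , r) → trans (e x y) p , q , r) w)

  subset-resp : ∀ {G : SimpleGraph k} {n} {S S' : EdgeSet k n} → S ≈E S' → IsEdgeSubset G n S → IsEdgeSubset G n S'
  subset-resp e (adj , S-sym) = (λ u v p → adj u v (trans (e u v) p)) , λ u v → trans (sym (e u v)) (trans (S-sym u v) (e v u))

-- Set partitions of [k], given as Boolean equivalence relations.  A block is represented by
-- its least element, its leader; the leaders are counted by nblocks.

module Partitions (k : ℕ) where

  true≢false : ¬ (true ≡ false)
  true≢false ()

  ∧-intro : ∀ {a b : Bool} → a ≡ true → b ≡ true → (a ∧ b) ≡ true
  ∧-intro refl refl = refl

  ∧-elim : ∀ {a b : Bool} → (a ∧ b) ≡ true → a ≡ true × b ≡ true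
  ∧-elim {a} {b} h = BP.∧-conicalˡ a b h , BP.∧-conicalʳ a b h

  anyFin-witness : ∀ {n} (f : Fin n → Bool) → anyFin f ≡ true → ∃ λ i → f i ≡ true
  anyFin-witness {suc n} f any with f zero in eq
  ... | true = zero , eq
  ... | false with anyFin-witness (λ i → f (suc i)) any
  ... | i , fi = suc i , fi

  anyFin-intro : ∀ {n} (f : Fin n → Bool) i → f i ≡ true → anyFin f ≡ true
  anyFin-intro f zero fi rewrite fi = refl
  anyFin-intro f (suc i) fi with f zero
  ... | true = refl
  ... | false = anyFin-intro (λ i → f (suc i)) i fi

  anyFin-cong : ∀ {n} {f g : Fin n → Bool} → (∀ j → f j ≡ g j) → anyFin f ≡ anyFin g
  anyFin-cong {zero} h = refl
  anyFin-cong {suc n} h = cong₂ _∨_ (h zero) (anyFin-cong (λ j → h (suc j)))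

  countFin-cong : ∀ {n} {f g : Fin n → Bool} → (∀ j → f j ≡ g j) → countFin f ≡ countFin g
  countFin-cong {zero} h = refl
  countFin-cong {suc n} {f} {g} h =
    cong₂ (λ x y → (if x then 1 else 0) + y) (h zero) (countFin-cong (λ j → h (suc j)))

  count-true : ∀ {n} (f : Fin n → Bool) → Count _≡_ (λ i → f i ≡ true) (countFin f)
  count-true {zero} f = Counting.count-none (λ ())
  count-true {suc n} f with count-true (λ i → f (suc i)) | f zero in eq
  ... | c | true = record { elems = el ; sound = so ; distinct = di ; complete = co }
    where
    open Count c
    el : Fin (suc (countFin (λ i → f (suc i)))) → Fin (suc n)
    el zero = zero
    el (suc i) = suc (elems i)
    so : ∀ i → f (el i) ≡ true
    so zero = eq
    so (suc i) = sound i
    di : ∀ i j → el i ≡ el j → i ≡ j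
    di zero zero _ = refl
    di (suc i) (suc j) e = cong suc (distinct i j (FP.suc-injective e))
    co : ∀ x → f x ≡ true → ∃ λ i → el i ≡ x
    co zero _ = zero , refl
    co (suc x) fx = let (i , e) = complete x fx in suc i , cong suc e
  ... | c | false = record { elems = λ i → suc (elems i) ; sound = sound
                           ; distinct = λ i j e → distinct i j (FP.suc-injective e) ; complete = co }
    where
    open Count c
    co : ∀ x → f x ≡ true → ∃ λ i → suc (elems i) ≡ x
    co zero f0 = ⊥-elim (true≢false (trans (sym f0) eq))
    co (suc x) fx = let (i , e) = complete x fx in i , cong suc e

  isLeader : Part k → Fin k → Bool
  isLeader P i = not (anyFin (λ j → (toℕ j <ᵇ toℕ i) ∧ P i j))

  <ᵇ⇒< : ∀ {m n} → (m <ᵇ n) ≡ true → m < n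
  <ᵇ⇒< {m} {n} e = ℕP.<ᵇ⇒< m n (subst T (sym e) tt)

  <⇒<ᵇ : ∀ {m n} → m < n → (m <ᵇ n) ≡ true
  <⇒<ᵇ {m} {n} lt with m <ᵇ n | ℕP.<⇒<ᵇ lt
  ... | true | _ = refl

  not-leader : ∀ (P : Part k) {i j} → toℕ j < toℕ i → P i j ≡ true → isLeader P i ≡ false
  not-leader P {i} {j} j<i Pij =
    cong not (anyFin-intro (λ j → (toℕ j <ᵇ toℕ i) ∧ P i j) j (∧-intro (<⇒<ᵇ j<i) Pij))

  leader-unique : ∀ (P : Part k) → IsPartition P → ∀ l l' → isLeader P l ≡ true → isLeader P l' ≡ true →
    P l l' ≡ true → l ≡ l'
  leader-unique P (_ , P-sym , _) l l' ll ll' Pll' with ℕP.<-cmp (toℕ l) (toℕ l')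
  ... | tri≈ _ e _ = FP.toℕ-injective e
  ... | tri< lt _ _ = ⊥-elim (true≢false (trans (sym ll') (not-leader P lt (P-sym _ _ Pll'))))
  ... | tri> _ _ gt = ⊥-elim (true≢false (trans (sym ll) (not-leader P gt Pll')))

  -- the least element of the block of i (by descent along earlier block members)
  leader-exists : ∀ (P : Part k) → IsPartition P → ∀ i → ∃ λ l → P i l ≡ true × isLeader P l ≡ true
  leader-exists P (P-refl , _ , P-trans) i = go (suc (toℕ i)) i (ℕP.n<1+n _)
    where
    go : ∀ fuel i → toℕ i < fuel → ∃ λ l → P i l ≡ true × isLeader P l ≡ true
    go (suc fuel) i lt with anyFin (λ j → (toℕ j <ᵇ toℕ i) ∧ P i j) in eq
    ... | false = i , P-refl i , cong not eq
    ... | true with anyFin-witness _ eq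
    ... | j , h with ∧-elim {toℕ j <ᵇ toℕ i} h
    ... | j<i , Pij with go fuel j (ℕP.<-≤-trans (<ᵇ⇒< j<i) (ℕP.≤-pred lt))
    ... | l , Pjl , ll = l , P-trans _ _ _ Pij Pjl , ll

  leaders : (P : Part k) → Count _≡_ (λ i → isLeader P i ≡ true) (nblocks P)
  leaders P = count-true (isLeader P)

  nblocks-cong : ∀ {P P' : Part k} → P ≈P P' → nblocks P ≡ nblocks P'
  nblocks-cong h = countFin-cong (λ i → cong not (anyFin-cong (λ j → cong ((toℕ j <ᵇ toℕ i) ∧_) (h i j))))

  eqB : Fin k → Fin k → Bool
  eqB a b = does (a FP.≟ b)

  eqB⇒≡ : ∀ {a b} → eqB a b ≡ true → a ≡ b
  eqB⇒≡ {a} {b} e with a FP.≟ b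
  ... | yes p = p

  eqB-refl : ∀ a → eqB a a ≡ true
  eqB-refl a with a FP.≟ a
  ... | yes _ = refl
  ... | no n = ⊥-elim (n refl)

  eqB-sym : ∀ a a' → eqB a a' ≡ eqB a' a
  eqB-sym a a' with a FP.≟ a' | a' FP.≟ a
  ... | yes _ | yes _ = refl
  ... | no _ | no _ = refl
  ... | yes p | no n = ⊥-elim (n (sym p))
  ... | no n | yes p = ⊥-elim (n (sym p))

  discrete : Part k
  discrete = eqB

  discrete-isPartition : IsPartition discrete
  discrete-isPartition = eqB-refl , (λ i j h → trans (eqB-sym j i) h) ,
    (λ i j l h₁ h₂ → subst (λ z → eqB i z ≡ true) (eqB⇒≡ {j} {l} h₂) h₁)

-- For k ≥ 1 the one-block partition is the unique partition with one block, and every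
-- partition has at least one block; hence it is the first in any ordered enumeration.

module FirstPartition (k' : ℕ) where

  open Partitions (suc k')

  countFin-false : ∀ {n} → countFin {n} (λ _ → false) ≡ 0
  countFin-false {zero} = refl
  countFin-false {suc n} = countFin-false {n}

  countFin≡0 : ∀ {n} (f : Fin n → Bool) → countFin f ≡ 0 → ∀ i → f i ≡ false
  countFin≡0 f h zero with f zero
  ... | false = refl
  countFin≡0 f h (suc i) with f zero
  ... | false = countFin≡0 (λ j → f (suc j)) h i

  anyFin-false : ∀ {n} → anyFin {n} (λ _ → false) ≡ false
  anyFin-false {zero} = refl
  anyFin-false {suc n} = anyFin-false {n}

  leader-zero : ∀ (P : Part (suc k')) → isLeader P zero ≡ true
  leader-zero P = cong not (anyFin-false {suc k'})

  nblocks≥1 : ∀ P → 1 ≤ nblocks P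
  nblocks≥1 P rewrite leader-zero P = s≤s z≤n

  oneBlock : Part (suc k')
  oneBlock _ _ = true

  oneBlock-isPartition : IsPartition oneBlock
  oneBlock-isPartition = (λ _ → refl) , (λ _ _ _ → refl) , (λ _ _ _ _ _ → refl)

  -- in the one-block partition only 0 is a leader
  nblocks-oneBlock : nblocks oneBlock ≡ 1
  nblocks-oneBlock rewrite leader-zero oneBlock =
    cong suc (trans (countFin-cong (λ i → not-leader oneBlock {suc i} {zero} (s≤s z≤n) refl))
                    (countFin-false {k'}))

  -- if 0 is the only leader, every element descends to 0, so all are related
  nblocks≡1⇒oneBlock : ∀ P → IsPartition P → nblocks P ≡ 1 → ∀ a b → P a b ≡ true
  nblocks≡1⇒oneBlock P isP@(_ , P-sym , P-trans) one a b = P-trans a zero b (to-zero a) (P-sym b zero (to-zero b))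
    where
    others : ∀ i → isLeader P (suc i) ≡ false
    others = countFin≡0 (λ i → isLeader P (suc i)) (ℕP.suc-injective (subst (λ x → (if x then 1 else 0) + countFin (λ i → isLeader P (suc i)) ≡ 1)
                                                                   (leader-zero P) one))
    to-zero : ∀ a → P a zero ≡ true
    to-zero a with leader-exists P isP a
    ... | zero , Pa0 , _ = Pa0
    ... | suc l , _ , ll = ⊥-elim (true≢false (trans (sym ll) (others l)))

  first-is-oneBlock : ∀ {b} {ps : Fin (suc b) → Part (suc k')} → IsOrderedEnumeration ps →
    ∀ a a' → ps zero a a' ≡ true
  first-is-oneBlock {ps = ps} (ps-part , _ , ps-complete , ps-ordered) a a'
    with ps-complete oneBlock oneBlock-isPartition
  ... | zero , one≈ = sym (one≈ a a')
  ... | suc i , one≈ with ps-ordered zero (suc i) (s≤s z≤n)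
  ... | inj₁ fewer = ⊥-elim (ℕP.<-irrefl refl (ℕP.<-≤-trans
          (subst (nblocks (ps zero) <_) (trans (sym (nblocks-cong one≈)) nblocks-oneBlock) fewer)
          (nblocks≥1 (ps zero))))
  ... | inj₂ (same , j , _ , differ , _) = ⊥-elim (differ (λ l → trans (all j l) (one≈ j l)))
    where
    all : ∀ a b → ps zero a b ≡ true
    all = nblocks≡1⇒oneBlock (ps zero) (ps-part zero) (trans same (trans (sym (nblocks-cong one≈)) nblocks-oneBlock))

-- Forests consistent with a partition, in the form used for gluing: instead of counting
-- trees we ask that every vertex be connected to the last column.  Given that the last
-- column induces P, this is equivalent to having exactly nblocks P trees.

module Consistency (k : ℕ) (G : SimpleGraph k) where

  open Vertices k
  open Partitions k

  record Consistent (m : ℕ) (P : Part k) (S : EdgeSet k (suc m)) : Set where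
    field
      subgraph   : IsEdgeSubset G (suc m) S
      acyclic    : W.Acyclic S
      rooted     : ∀ v → ∃ λ i → Reach S (i , fromℕ m) v
      sameTree⇒P : ∀ i j → Reach S (i , fromℕ m) (j , fromℕ m) → P i j ≡ true
      P⇒sameTree : ∀ i j → P i j ≡ true → Reach S (i , fromℕ m) (j , fromℕ m)

  subgraph-irreflexive : ∀ {n} {S : EdgeSet k n} → IsEdgeSubset G n S → ∀ u → S u u ≡ false
  subgraph-irreflexive {n} {S} (adj , _) u with S u u in eq
  ... | false = refl
  ... | true with adj u u eq
  ... | inj₁ (_ , inj₁ p) = ⊥-elim (ℕP.1+n≢n p)
  ... | inj₁ (_ , inj₂ p) = ⊥-elim (ℕP.1+n≢n p)
  ... | inj₂ (_ , p) = ⊥-elim (true≢false (trans (sym p) (SimpleGraph.irrefl G (proj₁ u))))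

  noCycle⇔acyclic : ∀ {n} {S : EdgeSet k n} → IsEdgeSubset G n S → (¬ HasCycle S → W.Acyclic S) × (W.Acyclic S → ¬ HasCycle S)
  noCycle⇔acyclic sub = W.noCycle⇒acyclic (subgraph-irreflexive sub) , W.acyclic⇒noCycle

  module _ {m : ℕ} {P : Part k} (isP : IsPartition P) {S : EdgeSet k (suc m)} where

    -- the trees are represented by the leaders of the blocks of P in the last column
    consistent⇒ConsistentWith : Consistent m P S → ConsistentWith G m P S
    consistent⇒ConsistentWith c =
      (subgraph , proj₂ (noCycle⇔acyclic subgraph) acyclic) , (root , root-distinct , root-covers) ,
      λ i j → sameTree⇒P i j , P⇒sameTree i j
      where
      open Consistent c
      open Count (leaders P)
      root : Fin (nblocks P) → Vtx k (suc m)
      root i = elems i , fromℕ m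
      root-distinct : ∀ i j → Reach S (root i) (root j) → i ≡ j
      root-distinct i j r = distinct i j (leader-unique P isP _ _ (sound i) (sound j) (sameTree⇒P _ _ r))
      root-covers : ∀ v → ∃ λ i → Reach S (root i) v
      root-covers v with rooted v
      ... | x , x→v with leader-exists P isP x
      ... | l , Pxl , ll with complete l ll
      ... | i , refl = i , (P⇒sameTree l x (proj₁ (proj₂ isP) _ _ Pxl) ◅◅ x→v)

    -- conversely, a vertex not connected to the last column would be a further tree
    ConsistentWith⇒consistent : ConsistentWith G m P S → Consistent m P S
    ConsistentWith⇒consistent ((sub , noCycle) , (root , root-distinct , root-covers) , induced) = record
      { subgraph = sub ; acyclic = proj₁ (noCycle⇔acyclic sub) noCycle ; rooted = rooted
      ; sameTree⇒P = λ i j → proj₁ (induced i j) ; P⇒sameTree = λ i j → proj₂ (induced i j) }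
      where
      open Count (leaders P)
      rev : ∀ {u v} → Reach S u v → Reach S v u
      rev = reach-sym (proj₂ sub)
      rooted : ∀ v → ∃ λ i → Reach S (i , fromℕ m) v
      rooted v with FP.any? (λ i → reach? S (i , fromℕ m) v)
      ... | yes p = p
      ... | no unreachable = ⊥-elim (two-in-one-tree (FP.pigeonhole (ℕP.n<1+n _) tree))
        where
        -- v together with the leaders are nblocks P + 1 vertices in distinct trees
        vertex : Fin (suc (nblocks P)) → Vtx k (suc m)
        vertex zero = v
        vertex (suc i) = elems i , fromℕ m
        tree : Fin (suc (nblocks P)) → Fin (nblocks P)
        tree x = proj₁ (root-covers (vertex x))
        connected : ∀ x y → tree x ≡ tree y → Reach S (vertex x) (vertex y)
        connected x y same = rev (proj₂ (root-covers (vertex x))) ◅◅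
          subst (λ z → Reach S (root z) (vertex y)) (sym same) (proj₂ (root-covers (vertex y)))
        two-in-one-tree : ¬ (∃ λ x → ∃ λ y → x F.< y × tree x ≡ tree y)
        two-in-one-tree (zero , suc y , _ , same) = unreachable (_ , rev (connected zero (suc y) same))
        two-in-one-tree (suc x , suc y , x<y , same) = ℕP.<⇒≢ (ℕP.≤-pred x<y) (cong toℕ (distinct x y
          (leader-unique P isP _ _ (sound x) (sound y) (proj₁ (induced _ _) (connected (suc x) (suc y) same)))))

  consistent-resp : ∀ {m P} {S S' : EdgeSet k (suc m)} → S ≈E S' → Consistent m P S → Consistent m P S'
  consistent-resp e c = record
    { subgraph = subset-resp {G} e subgraph ; acyclic = acyclic-resp e acyclic
    ; rooted = λ v → proj₁ (rooted v) , reach-resp e (proj₂ (rooted v))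
    ; sameTree⇒P = λ i j r → sameTree⇒P i j (reach-resp (≈E.sym e) r)
    ; P⇒sameTree = λ i j p → reach-resp e (P⇒sameTree i j p) }
    where open Consistent c

-- The gadget K = G × P_2: column c0 stands for the last column of G_n, column c1 for the
-- new column of G_{n+1}.  For a partition Q of the old column and a set e of allowed
-- edges (rungs and edges of G in the new column), D Q e adds to e a clique on each block
-- of Q, which records the connections provided by a forest of G_n.  e is valid for (Q , P)
-- when no edge of e lies on a cycle of D Q e, every old vertex reaches the new column, and
-- the new column is partitioned as P.  Validity is decidable, so the valid e are counted.

module Gadget (k : ℕ) (G : SimpleGraph k) where

  open Vertices k
  open Partitions k
  open Counting
  open SimpleGraph G using (adj)

  K : Set
  K = Vtx k 2

  c0 c1 : Fin 2
  c0 = zero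
  c1 = suc zero

  allowed : K → K → Bool
  allowed (a , zero) (b , zero) = false
  allowed (a , zero) (b , suc zero) = eqB a b
  allowed (a , suc zero) (b , zero) = eqB a b
  allowed (a , suc zero) (b , suc zero) = adj a b

  clique : Part k → K → K → Bool
  clique Q (a , zero) (b , zero) = Q a b
  clique Q (a , zero) (b , suc zero) = false
  clique Q (a , suc zero) (b , _) = false

  D : Part k → EdgeSet k 2 → EdgeSet k 2
  D Q e u v = clique Q u v ∨ e u v

  record Valid (Q P : Part k) (e : EdgeSet k 2) : Set where
    field
      onlyAllowed : ∀ u v → e u v ≡ true → allowed u v ≡ true
      symmetric   : ∀ u v → e u v ≡ e v u
      acyclic     : ∀ a b → e a b ≡ true → ¬ Star (W.Without (D Q e) a b) b a
      reachesNew  : ∀ l → ∃ λ j → Reach (D Q e) (l , c0) (j , c1)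
      newTree⇒P   : ∀ i j → Reach (D Q e) (i , c1) (j , c1) → P i j ≡ true
      P⇒newTree   : ∀ i j → P i j ≡ true → Reach (D Q e) (i , c1) (j , c1)

  allK? : ∀ {n} {R : Vtx k n → Set} → (∀ u → Dec (R u)) → Dec (∀ u → R u)
  allK? R? = map′ (λ f u → f (proj₁ u) (proj₂ u)) (λ f a b → f (a , b))
    (FP.all? (λ a → FP.all? (λ b → R? (a , b))))

  valid? : ∀ Q P e → Dec (Valid Q P e)
  valid? Q P e = map′ (λ (a , b , c , d , f , g) → record
                          { onlyAllowed = a ; symmetric = b ; acyclic = c ; reachesNew = d ; newTree⇒P = f ; P⇒newTree = g })
    (λ v → let open Valid v in onlyAllowed , symmetric , acyclic , reachesNew , newTree⇒P , P⇒newTree)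
    (allK? (λ u → allK? (λ v → isTrue? (e u v) →-dec isTrue? (allowed u v))) ×-dec
     allK? (λ u → allK? (λ v → e u v BP.≟ e v u)) ×-dec
     allK? (λ a → allK? (λ b → isTrue? (e a b) →-dec ¬? (R.star? (without? (D Q e) a b) b a))) ×-dec
     FP.all? (λ l → FP.any? (λ j → reach? (D Q e) (l , c0) (j , c1))) ×-dec
     FP.all? (λ i → FP.all? (λ j → reach? (D Q e) (i , c1) (j , c1) →-dec isTrue? (P i j))) ×-dec
     FP.all? (λ i → FP.all? (λ j → isTrue? (P i j) →-dec reach? (D Q e) (i , c1) (j , c1))))

  valid-resp : ∀ {Q Q' P e e'} → Q ≈P Q' → e ≈E e' → Valid Q P e → Valid Q' P e'
  valid-resp {Q} {Q'} {P} {e} {e'} Q≈ e≈ v = record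
    { onlyAllowed = λ u w h → onlyAllowed u w (trans (e≈ u w) h)
    ; symmetric = λ u w → trans (sym (e≈ u w)) (trans (symmetric u w) (e≈ w u))
    ; acyclic = λ a b h w → acyclic a b (trans (e≈ a b) h)
                  (Star.map (λ {x} {y} (p , q , r) → trans (sym (D≈ x y)) p , q , r) w)
    ; reachesNew = λ l → proj₁ (reachesNew l) , reach-resp (≈E.sym D≈) (proj₂ (reachesNew l))
    ; newTree⇒P = λ i j r → newTree⇒P i j (reach-resp D≈ r)
    ; P⇒newTree = λ i j p → reach-resp (≈E.sym D≈) (P⇒newTree i j p) }
    where
    open Valid v
    clique≈ : ∀ p q → clique Q' p q ≡ clique Q p q
    clique≈ (a , zero) (a' , zero) = sym (Q≈ a a')
    clique≈ (a , zero) (a' , suc zero) = refl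
    clique≈ (a , suc zero) (a' , _) = refl
    D≈ : D Q' e' ≈E D Q e
    D≈ p q = cong₂ _∨_ (clique≈ p q) (sym (e≈ p q))

  edgeSets : Count _≈E_ (λ (_ : EdgeSet k 2) → ⊤) _
  edgeSets = count-functions (pointwise-equiv ≡-equiv) vertices
               (count-functions ≡-equiv vertices finite-Bool)
    where
    vertices : Finite K (k * 2)
    vertices = finite-× (finite-Fin k) (finite-Fin 2)

  count-valid : ∀ Q P → ∃ λ N → Count _≈E_ (Valid Q P) N
  count-valid Q P with count-filter ≈E-equiv edgeSets (valid? Q P) (λ _ _ _ _ → tt)
                                    (λ x y e → valid-resp (λ _ _ → refl) e)
  ... | N , c = N , count-cong c (λ _ → proj₂) (λ _ v → tt , v)

-- A spanning subgraph of G_{m+2} is the same as a spanning subgraph F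
-- of G_{m+1} (its old part) together with an allowed edge set e of the gadget (its
-- gadget part), glued along the last old column.  Gluing preserves and reflects
-- consistency: if F induces Q on its last column, then F is consistent with Q and e is
-- valid for (Q , P) iff glue F e is consistent with P.  The comparison rests on two maps
-- of walks: ψ embeds the gadget into G_{m+2} (a clique edge of D Q e becomes a walk in
-- F), and φ collapses every old vertex onto the root of its tree in the last old column.

module Gluing (k : ℕ) (G : SimpleGraph k) where

  open Vertices k
  open Partitions k
  open Consistency k G
  open Gadget k G
  open SimpleGraph G using (adj) renaming (sym to adj-sym)

  data LastView {n : ℕ} : Fin (suc n) → Set where
    old : (j : Fin n) → LastView (inject₁ j)
    new : LastView (fromℕ n)

  lastView : ∀ {n} (b : Fin (suc n)) → LastView b
  lastView {zero} zero = new
  lastView {suc n} zero = old zero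
  lastView {suc n} (suc b) with lastView b
  ... | old j = old (suc j)
  ... | new = new

  lastView-old : ∀ {n} (j : Fin n) → lastView (inject₁ j) ≡ old j
  lastView-old {suc n} zero = refl
  lastView-old {suc n} (suc j) rewrite lastView-old j = refl

  lastView-new : ∀ n → lastView (fromℕ n) ≡ new
  lastView-new zero = refl
  lastView-new (suc n) rewrite lastView-new n = refl

  new≢old : ∀ {n} {j : Fin n} → ¬ (fromℕ n ≡ inject₁ j)
  new≢old = FP.fromℕ≢inject₁

  module Step (m : ℕ) where

    V V₀ : Set
    V = Vtx k (suc (suc m))
    V₀ = Vtx k (suc m)

    lastOld newCol : Fin (suc (suc m))
    lastOld = inject₁ (fromℕ m)
    newCol = fromℕ (suc m)

    isLast : Fin (suc m) → Bool
    isLast j = does (j FP.≟ fromℕ m)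

    isLast⇒≡ : ∀ {j} → isLast j ≡ true → j ≡ fromℕ m
    isLast⇒≡ {j} e with j FP.≟ fromℕ m
    ... | yes p = p

    isLast-last : isLast (fromℕ m) ≡ true
    isLast-last with fromℕ m FP.≟ fromℕ m
    ... | yes _ = refl
    ... | no n = ⊥-elim (n refl)

    glueAt : EdgeSet k (suc m) → EdgeSet k 2 → Fin k → Fin k →
      {b b' : Fin (suc (suc m))} → LastView b → LastView b' → Bool
    glueAt F e a a' (old j) (old j') = F (a , j) (a' , j')
    glueAt F e a a' (old j) new = isLast j ∧ e (a , c0) (a' , c1)
    glueAt F e a a' new (old j') = isLast j' ∧ e (a , c1) (a' , c0)
    glueAt F e a a' new new = e (a , c1) (a' , c1)

    glue : EdgeSet k (suc m) → EdgeSet k 2 → EdgeSet k (suc (suc m))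
    glue F e (a , b) (a' , b') = glueAt F e a a' (lastView b) (lastView b')

    up : V₀ → V
    up (a , j) = (a , inject₁ j)

    ψ : K → V
    ψ (a , zero) = a , lastOld
    ψ (a , suc zero) = a , newCol

    oldPart : EdgeSet k (suc (suc m)) → EdgeSet k (suc m)
    oldPart S u w = S (up u) (up w)

    gadgetPart : EdgeSet k (suc (suc m)) → EdgeSet k 2
    gadgetPart S p q = allowed p q ∧ S (ψ p) (ψ q)

    module _ {F : EdgeSet k (suc m)} {e : EdgeSet k 2} where
      glue-old-old : ∀ a a' j j' → glue F e (a , inject₁ j) (a' , inject₁ j') ≡ F (a , j) (a' , j')
      glue-old-old a a' j j' rewrite lastView-old j | lastView-old j' = refl
      glue-old-new : ∀ a a' j → glue F e (a , inject₁ j) (a' , newCol) ≡ (isLast j ∧ e (a , c0) (a' , c1))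
      glue-old-new a a' j rewrite lastView-old j | lastView-new (suc m) = refl
      glue-new-old : ∀ a a' j → glue F e (a , newCol) (a' , inject₁ j) ≡ (isLast j ∧ e (a , c1) (a' , c0))
      glue-new-old a a' j rewrite lastView-old j | lastView-new (suc m) = refl
      glue-new-new : ∀ a a' → glue F e (a , newCol) (a' , newCol) ≡ e (a , c1) (a' , c1)
      glue-new-new a a' rewrite lastView-new (suc m) = refl

    toℕ-lastOld : toℕ lastOld ≡ m
    toℕ-lastOld = trans (FP.toℕ-inject₁ (fromℕ m)) (FP.toℕ-fromℕ m)

    toℕ-newCol : toℕ newCol ≡ suc m
    toℕ-newCol = FP.toℕ-fromℕ (suc m)

    old<new : ∀ (j : Fin (suc m)) → toℕ (inject₁ j) < toℕ newCol
    old<new j = subst₂ _<_ (sym (FP.toℕ-inject₁ j)) (sym toℕ-newCol) (FP.toℕ<n j)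

    adj-old-new : ∀ {a a' j} → ProdAdj G (suc (suc m)) (a , inject₁ j) (a' , newCol) → j ≡ fromℕ m × a ≡ a'
    adj-old-new {j = j} (inj₁ (a≡a' , inj₁ p)) = FP.toℕ-injective j≡m , a≡a'
      where
      j≡m : toℕ j ≡ toℕ (fromℕ m)
      j≡m = ℕP.suc-injective (trans (cong suc (sym (FP.toℕ-inject₁ j)))
                               (trans p (trans toℕ-newCol (cong suc (sym (FP.toℕ-fromℕ m))))))
    adj-old-new {j = j} (inj₁ (_ , inj₂ p)) = ⊥-elim (ℕP.<-asym (old<new j) (ℕP.≤-reflexive p))
    adj-old-new (inj₂ (b≡b' , _)) = ⊥-elim (new≢old (sym b≡b'))

    adj-new-new : ∀ {a a'} → ProdAdj G (suc (suc m)) (a , newCol) (a' , newCol) → adj a a' ≡ true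
    adj-new-new (inj₁ (_ , inj₁ p)) = ⊥-elim (ℕP.1+n≢n p)
    adj-new-new (inj₁ (_ , inj₂ p)) = ⊥-elim (ℕP.1+n≢n p)
    adj-new-new (inj₂ (_ , h)) = h

    adj-up : ∀ {u w} → ProdAdj G (suc m) u w → ProdAdj G (suc (suc m)) (up u) (up w)
    adj-up {a , j} {a' , j'} (inj₁ (aa , inj₁ p)) =
      inj₁ (aa , inj₁ (trans (cong suc (FP.toℕ-inject₁ j)) (trans p (sym (FP.toℕ-inject₁ j')))))
    adj-up {a , j} {a' , j'} (inj₁ (aa , inj₂ p)) =
      inj₁ (aa , inj₂ (trans (cong suc (FP.toℕ-inject₁ j')) (trans p (sym (FP.toℕ-inject₁ j)))))
    adj-up (inj₂ (bb , h)) = inj₂ (cong inject₁ bb , h)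

    adj-down : ∀ {u w} → ProdAdj G (suc (suc m)) (up u) (up w) → ProdAdj G (suc m) u w
    adj-down {a , j} {a' , j'} (inj₁ (aa , inj₁ p)) =
      inj₁ (aa , inj₁ (trans (cong suc (sym (FP.toℕ-inject₁ j))) (trans p (FP.toℕ-inject₁ j'))))
    adj-down {a , j} {a' , j'} (inj₁ (aa , inj₂ p)) =
      inj₁ (aa , inj₂ (trans (cong suc (sym (FP.toℕ-inject₁ j'))) (trans p (FP.toℕ-inject₁ j))))
    adj-down (inj₂ (bb , h)) = inj₂ (FP.inject₁-injective bb , h)

    allowed-sym : ∀ p q → allowed p q ≡ allowed q p
    allowed-sym (a , zero) (a' , zero) = refl
    allowed-sym (a , zero) (a' , suc zero) = eqB-sym a a'
    allowed-sym (a , suc zero) (a' , zero) = eqB-sym a a'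
    allowed-sym (a , suc zero) (a' , suc zero) = adj-sym a a'

    oldPart-glue : ∀ F e → oldPart (glue F e) ≈E F
    oldPart-glue F e (a , j) (a' , j') = glue-old-old {F} {e} a a' j j'

    gadgetPart-glue : ∀ F e → (∀ u v → e u v ≡ true → allowed u v ≡ true) → gadgetPart (glue F e) ≈E e
    gadgetPart-glue F e e-allowed (a , zero) (a' , zero) with e (a , c0) (a' , c0) in eq
    ... | false = refl
    ... | true = ⊥-elim (true≢false (sym (e-allowed _ _ eq)))
    gadgetPart-glue F e e-allowed (a , zero) (a' , suc zero)
      rewrite glue-old-new {F} {e} a a' (fromℕ m) | isLast-last with e (a , c0) (a' , c1) in eq
    ... | false = BP.∧-zeroʳ _
    ... | true rewrite e-allowed _ _ eq = refl
    gadgetPart-glue F e e-allowed (a , suc zero) (a' , zero)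
      rewrite glue-new-old {F} {e} a a' (fromℕ m) | isLast-last with e (a , c1) (a' , c0) in eq
    ... | false = BP.∧-zeroʳ _
    ... | true rewrite e-allowed _ _ eq = refl
    gadgetPart-glue F e e-allowed (a , suc zero) (a' , suc zero)
      rewrite glue-new-new {F} {e} a a' with e (a , c1) (a' , c1) in eq
    ... | false = BP.∧-zeroʳ _
    ... | true rewrite e-allowed _ _ eq = refl

    rung-part : ∀ (S : EdgeSet k (suc (suc m))) → (∀ u w → S u w ≡ true → ProdAdj G (suc (suc m)) u w) → ∀ a a' j →
      (isLast j ∧ (eqB a a' ∧ S (a , lastOld) (a' , newCol))) ≡ S (a , inject₁ j) (a' , newCol)
    rung-part S S-adj a a' j with S (a , inject₁ j) (a' , newCol) in eq
    ... | true with adj-old-new (S-adj _ _ eq)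
    ... | refl , refl rewrite isLast-last | eqB-refl a | eq = refl
    rung-part S S-adj a a' j | false with isLast j in jLast
    ... | false = refl
    ... | true with isLast⇒≡ {j} jLast
    ... | refl = trans (cong (eqB a a' ∧_) eq) (BP.∧-zeroʳ _)

    glue-parts : ∀ S → IsEdgeSubset G (suc (suc m)) S → glue (oldPart S) (gadgetPart S) ≈E S
    glue-parts S (S-adj , S-sym) (a , b) (a' , b') with lastView b | lastView b'
    ... | old j | old j' = refl
    ... | old j | new = rung-part S S-adj a a' j
    ... | new | old j = begin
      isLast j ∧ (eqB a a' ∧ S (a , newCol) (a' , lastOld))  ≡⟨ cong₂ (λ x y → isLast j ∧ (x ∧ y)) (eqB-sym a a') (S-sym _ _) ⟩
      isLast j ∧ (eqB a' a ∧ S (a' , lastOld) (a , newCol))  ≡⟨ rung-part S S-adj a' a j ⟩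
      S (a' , inject₁ j) (a , newCol)                       ≡⟨ S-sym _ _ ⟩
      S (a , newCol) (a' , inject₁ j)                       ∎
      where open ≡-Reasoning
    ... | new | new with S (a , newCol) (a' , newCol) in eq
    ... | true rewrite adj-new-new (S-adj _ _ eq) = refl
    ... | false = BP.∧-zeroʳ _

    IsOld : V → Set
    IsOld (a , b) = ∃ λ j → b ≡ inject₁ j

    isOld? : ∀ u → Dec (IsOld u)
    isOld? (a , b) with lastView b
    ... | old j = yes (j , refl)
    ... | new = no λ { (j , p) → new≢old p }

    BothOld : V → V → Set
    BothOld u w = IsOld u × IsOld w

    bothOld? : ∀ u w → Dec (BothOld u w)
    bothOld? u w = isOld? u ×-dec isOld? w

    ¬¬bothOld : ∀ {p q} → ¬ ¬ BothOld p q → BothOld p q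
    ¬¬bothOld {p} {q} nn with bothOld? p q
    ... | yes bo = bo
    ... | no nb = ⊥-elim (nn nb)

    ¬old-new : ∀ {a} → ¬ IsOld (a , newCol)
    ¬old-new (j , p) = new≢old p

    up-injective : ∀ {x y} → up x ≡ up y → x ≡ y
    up-injective {a , j} {a' , j'} h = cong₂ _,_ (cong proj₁ h) (FP.inject₁-injective (cong proj₂ h))

    -- a left inverse of up (the new column is sent to the last old one)
    lower : V → V₀
    lower (a , b) with lastView b
    ... | old j = a , j
    ... | new = a , fromℕ m

    lower-up : ∀ x → lower (up x) ≡ x
    lower-up (a , j) rewrite lastView-old j = refl

    up-lower : ∀ u → IsOld u → up (lower u) ≡ u
    up-lower (a , .(inject₁ j)) (j , refl) rewrite lastView-old j = refl

    ψ-injective : ∀ {p q} → ψ p ≡ ψ q → p ≡ q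
    ψ-injective {a , zero} {a' , zero} h = cong (_, zero) (cong proj₁ h)
    ψ-injective {a , zero} {a' , suc zero} h = ⊥-elim (new≢old (sym (cong proj₂ h)))
    ψ-injective {a , suc zero} {a' , zero} h = ⊥-elim (new≢old (cong proj₂ h))
    ψ-injective {a , suc zero} {a' , suc zero} h = cong (_, suc zero) (cong proj₁ h)

    up≢ψ-new : ∀ {a x} → ¬ (up x ≡ ψ (a , c1))
    up≢ψ-new h = new≢old (sym (cong proj₂ h))

    -- Walks are compared both plainly and avoiding one given gadget edge, the latter to
    -- transport cycles; an optional excluded edge covers both cases at once.
    ExcludedK : Maybe (K × K) → K → K → Set
    ExcludedK nothing p q = ⊥
    ExcludedK (just (a , b)) p q = (p ≡ a × q ≡ b) ⊎ (p ≡ b × q ≡ a)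

    ExcludedV : Maybe (K × K) → V → V → Set
    ExcludedV nothing u w = ⊥
    ExcludedV (just (a , b)) u w = (u ≡ ψ a × w ≡ ψ b) ⊎ (u ≡ ψ b × w ≡ ψ a)

    excludedK⇒V : ∀ ex {p q} → ExcludedK ex p q → ExcludedV ex (ψ p) (ψ q)
    excludedK⇒V (just _) (inj₁ (refl , refl)) = inj₁ (refl , refl)
    excludedK⇒V (just _) (inj₂ (refl , refl)) = inj₂ (refl , refl)

    excludedV⇒K : ∀ ex {p q} → ExcludedV ex (ψ p) (ψ q) → ExcludedK ex p q
    excludedV⇒K (just _) (inj₁ (h₁ , h₂)) = inj₁ (ψ-injective h₁ , ψ-injective h₂)
    excludedV⇒K (just _) (inj₂ (h₁ , h₂)) = inj₂ (ψ-injective h₁ , ψ-injective h₂)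

    module Comparison (F : EdgeSet k (suc m)) (e : EdgeSet k 2) (Q : Part k)
      (F-sub : IsEdgeSubset G (suc m) F)
      (Q-sound : ∀ a b → Reach F (a , fromℕ m) (b , fromℕ m) → Q a b ≡ true)
      (Q-complete : ∀ a b → Q a b ≡ true → Reach F (a , fromℕ m) (b , fromℕ m))
      (e-allowed : ∀ u v → e u v ≡ true → allowed u v ≡ true)
      (e-sym : ∀ u v → e u v ≡ e v u) where

      X : EdgeSet k (suc (suc m))
      X = glue F e

      DQ : EdgeSet k 2
      DQ = D Q e

      F-rev : ∀ {u w} → Reach F u w → Reach F w u
      F-rev = reach-sym (proj₂ F-sub)

      Q-sym : ∀ {a b} → Q a b ≡ true → Q b a ≡ true
      Q-sym {a} {b} h = Q-sound b a (F-rev (Q-complete a b h))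

      X-sym : ∀ u w → X u w ≡ X w u
      X-sym (a , b) (a' , b') with lastView b | lastView b'
      ... | old j | old j' = proj₂ F-sub (a , j) (a' , j')
      ... | old j | new = cong (isLast j ∧_) (e-sym _ _)
      ... | new | old j = cong (isLast j ∧_) (e-sym _ _)
      ... | new | new = e-sym _ _

      X-sub : IsEdgeSubset G (suc (suc m)) X
      X-sub = X-adj , X-sym
        where
        X-adj : ∀ u w → X u w ≡ true → ProdAdj G (suc (suc m)) u w
        X-adj (a , b) (a' , b') h with lastView b | lastView b'
        ... | old j | old j' = adj-up (proj₁ F-sub _ _ h)
        ... | old j | new with ∧-elim {isLast j} h
        ... | last , rung-e with isLast⇒≡ {j} last | eqB⇒≡ {a} {a'} (e-allowed _ _ rung-e)
        ... | refl | refl = inj₁ (refl , inj₁ (trans (cong suc toℕ-lastOld) (sym toℕ-newCol)))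
        X-adj (a , b) (a' , b') h | new | old j with ∧-elim {isLast j} h
        ... | last , rung-e with isLast⇒≡ {j} last | eqB⇒≡ {a} {a'} (e-allowed _ _ rung-e)
        ... | refl | refl = inj₁ (refl , inj₂ (trans (cong suc toℕ-lastOld) (sym toℕ-newCol)))
        X-adj (a , b) (a' , b') h | new | new = inj₂ (refl , e-allowed _ _ h)

      StepK : Maybe (K × K) → K → K → Set
      StepK ex p q = DQ p q ≡ true × ¬ ExcludedK ex p q

      StepV : Maybe (K × K) → V → V → Set
      StepV ex u w = X u w ≡ true × ¬ ExcludedV ex u w

      Admissible : Maybe (K × K) → Set
      Admissible nothing = ⊤
      Admissible (just (a , b)) = e a b ≡ true

      e-touches-new : ∀ {a b} → e a b ≡ true → proj₂ a ≡ c1 ⊎ proj₂ b ≡ c1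
      e-touches-new {x , zero} {y , zero} h = ⊥-elim (true≢false (sym (e-allowed _ _ h)))
      e-touches-new {x , zero} {y , suc zero} h = inj₂ refl
      e-touches-new {x , suc zero} {y , _} h = inj₁ refl

      old-not-excluded : ∀ ex → Admissible ex → ∀ {x y} → ¬ ExcludedV ex (up x) (up y)
      old-not-excluded (just (a , b)) ok ex with e-touches-new {a} {b} ok
      old-not-excluded (just ((_ , _) , b)) ok (inj₁ (h , _)) | inj₁ refl = up≢ψ-new h
      old-not-excluded (just ((_ , _) , b)) ok (inj₂ (_ , h)) | inj₁ refl = up≢ψ-new h
      old-not-excluded (just (a , (_ , _))) ok (inj₁ (_ , h)) | inj₂ refl = up≢ψ-new h
      old-not-excluded (just (a , (_ , _))) ok (inj₂ (h , _)) | inj₂ refl = up≢ψ-new h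

      clique-not-excluded : ∀ ex → Admissible ex → ∀ {x y} → ¬ ExcludedK ex (x , c0) (y , c0)
      clique-not-excluded (just (a , b)) ok ex with e-touches-new {a} {b} ok
      clique-not-excluded (just ((_ , _) , b)) ok (inj₁ (() , _)) | inj₁ refl
      clique-not-excluded (just ((_ , _) , b)) ok (inj₂ (_ , ())) | inj₁ refl
      clique-not-excluded (just (a , (_ , _))) ok (inj₁ (_ , ())) | inj₂ refl
      clique-not-excluded (just (a , (_ , _))) ok (inj₂ (() , _)) | inj₂ refl

      up-walk : ∀ ex → Admissible ex → ∀ {u w} → Reach F u w → Star (StepV ex) (up u) (up w)
      up-walk ex ok = kleisliStar up (λ {(a , j)} {(a' , j')} h →
        Star.return (trans (glue-old-old {F} {e} a a' j j') h , old-not-excluded ex ok))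

      ψ-e-edge : ∀ {p q} → e p q ≡ true → X (ψ p) (ψ q) ≡ true
      ψ-e-edge {a , zero} {a' , zero} h = ⊥-elim (true≢false (sym (e-allowed _ _ h)))
      ψ-e-edge {a , zero} {a' , suc zero} h rewrite glue-old-new {F} {e} a a' (fromℕ m) | isLast-last = h
      ψ-e-edge {a , suc zero} {a' , zero} h rewrite glue-new-old {F} {e} a a' (fromℕ m) | isLast-last = h
      ψ-e-edge {a , suc zero} {a' , suc zero} h rewrite glue-new-new {F} {e} a a' = h

      -- ψ maps walks of D Q e to walks of X: an edge of e is an edge of X, and a clique
      -- edge between Q-related vertices is replaced by a walk of F
      ψ-step : ∀ ex → Admissible ex → ∀ {p q} → StepK ex p q → Star (StepV ex) (ψ p) (ψ q)
      ψ-step ex ok {a , zero} {a' , zero} (h , _) with Q a a' in Qaa'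
      ... | true = up-walk ex ok (Q-complete a a' Qaa')
      ... | false = ⊥-elim (true≢false (sym (e-allowed _ _ h)))
      ψ-step ex ok {a , zero} {a' , suc zero} (h , nex) = Star.return (ψ-e-edge h , λ x → nex (excludedV⇒K ex x))
      ψ-step ex ok {a , suc zero} {a' , zero} (h , nex) = Star.return (ψ-e-edge h , λ x → nex (excludedV⇒K ex x))
      ψ-step ex ok {a , suc zero} {a' , suc zero} (h , nex) = Star.return (ψ-e-edge h , λ x → nex (excludedV⇒K ex x))

      ψ-walk : ∀ ex → Admissible ex → ∀ {p q} → Star (StepK ex) p q → Star (StepV ex) (ψ p) (ψ q)
      ψ-walk ex ok = kleisliStar ψ (ψ-step ex ok)

      clique-step : ∀ ex → Admissible ex → ∀ {x y} → Q x y ≡ true → StepK ex (x , c0) (y , c0)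
      clique-step ex ok {x} {y} h rewrite h = refl , clique-not-excluded ex ok

      e-step : ∀ ex {p q} → e p q ≡ true → ¬ ExcludedK ex p q → StepK ex p q
      e-step ex {p} {q} h nex = trans (cong (clique Q p q ∨_) h) (BP.∨-zeroʳ _) , nex

      toReachK : ∀ {p q} → Star (StepK nothing) p q → Reach DQ p q
      toReachK = Star.map proj₁
      fromReachK : ∀ {p q} → Reach DQ p q → Star (StepK nothing) p q
      fromReachK = Star.map (λ h → h , λ ())
      toReachV : ∀ {u w} → Star (StepV nothing) u w → Reach X u w
      toReachV = Star.map proj₁
      fromReachV : ∀ {u w} → Reach X u w → Star (StepV nothing) u w
      fromReachV = Star.map (λ h → h , λ ())

      toWithoutK : ∀ {a b p q} → Star (StepK (just (a , b))) p q → Star (W.Without DQ a b) p q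
      toWithoutK = Star.map (λ (h , n) → h , (λ x → n (inj₁ x)) , (λ x → n (inj₂ x)))
      fromWithoutK : ∀ {a b p q} → Star (W.Without DQ a b) p q → Star (StepK (just (a , b))) p q
      fromWithoutK = Star.map (λ (h , n₁ , n₂) → h , λ { (inj₁ x) → n₁ x ; (inj₂ x) → n₂ x })
      toWithoutV : ∀ {a b u w} → Star (StepV (just (a , b))) u w → Star (W.Without X (ψ a) (ψ b)) u w
      toWithoutV = Star.map (λ (h , n) → h , (λ x → n (inj₁ x)) , (λ x → n (inj₂ x)))
      fromWithoutV : ∀ {a b u w} → Star (W.Without X (ψ a) (ψ b)) u w → Star (StepV (just (a , b))) u w
      fromWithoutV = Star.map (λ (h , n₁ , n₂) → h , λ { (inj₁ x) → n₁ x ; (inj₂ x) → n₂ x })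

      acyclic-old : W.Acyclic X → W.Acyclic F
      acyclic-old ac a b h w = ac (up a) (up b) (trans (glue-old-old {F} {e} _ _ _ _) h)
        (kleisliStar up (λ {x} {y} (h , n₁ , n₂) → Star.return (trans (glue-old-old {F} {e} _ _ _ _) h ,
            (λ (p , q) → n₁ (up-injective p , up-injective q)) , (λ (p , q) → n₂ (up-injective p , up-injective q)))) w)

      acyclic-gadget : W.Acyclic X → ∀ a b → e a b ≡ true → ¬ Star (W.Without DQ a b) b a
      acyclic-gadget ac a b h w =
        ac (ψ a) (ψ b) (ψ-e-edge h) (toWithoutV {a} {b} (ψ-walk (just (a , b)) h (fromWithoutK w)))

      gadget-edge : ∀ {c d} → X c d ≡ true → ¬ BothOld c d → ∃ λ a → ∃ λ b → e a b ≡ true × c ≡ ψ a × d ≡ ψ b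
      gadget-edge {x , b} {y , b'} h nb with lastView b | lastView b'
      ... | old j | old j' = ⊥-elim (nb ((j , refl) , (j' , refl)))
      ... | old j | new with ∧-elim {isLast j} h
      ... | last , rung-e with isLast⇒≡ {j} last
      ... | refl = (x , c0) , (y , c1) , rung-e , refl , refl
      gadget-edge {x , b} {y , b'} h nb | new | old j with ∧-elim {isLast j} h
      ... | last , rung-e with isLast⇒≡ {j} last
      ... | refl = (x , c1) , (y , c0) , rung-e , refl , refl
      gadget-edge {x , b} {y , b'} h nb | new | new = (x , c1) , (y , c1) , h , refl , refl

      X-old : ∀ x y → BothOld x y → X x y ≡ F (lower x) (lower y)
      X-old x y (ox , oy) = trans (cong₂ X (sym (up-lower x ox)) (sym (up-lower y oy))) (glue-old-old {F} {e} _ _ _ _)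

      OldStep : V → V → Set
      OldStep = (Edge X) W.∖ (λ p q → ¬ BothOld p q)

      oldWalk-end : ∀ {x y} → Star OldStep x y → IsOld x → IsOld y
      oldWalk-end ε o = o
      oldWalk-end (_◅_ {i = x} {j = z} s w) _ = oldWalk-end w (proj₂ (¬¬bothOld {x} {z} (proj₂ s)))

      lowerWalk : ∀ {x y} → Star OldStep x y → Reach F (lower x) (lower y)
      lowerWalk = kleisliStar {T = OldStep} {U = Edge F} lower
        (λ {p} {q} (h , nn) → Star.return (trans (sym (X-old p q (¬¬bothOld {p} {q} nn))) h))

      -- if X is rooted in the new column, F is rooted in its last column: a walk from an
      -- old vertex to the new column leaves the old columns by a rung at the last old column
      rooted-old : (∀ v → ∃ λ i → Reach X (i , newCol) v) → ∀ u → ∃ λ l → Reach F (l , fromℕ m) u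
      rooted-old X-rooted u with X-rooted (up u)
      ... | i , r with W.splitFirst (λ x y → ¬? (bothOld? x y)) (reach-sym X-sym r)
      ... | inj₁ t = ⊥-elim (¬old-new {i} (oldWalk-end t (proj₂ u , refl)))
      ... | inj₂ (c , d , s₁ , cd , ¬bo , _ , _) with gadget-edge cd ¬bo | oldWalk-end s₁ (proj₂ u , refl)
      ... | (a , zero) , _ , _ , refl , _ | _ =
        a , F-rev (subst₂ (Reach F) (lower-up u) (lower-up (a , fromℕ m)) (lowerWalk s₁))
      ... | (a , suc zero) , _ , _ , refl , _ | oc = ⊥-elim (¬old-new {a} oc)

      -- Given roots for F (each vertex is reached from its root in the last column), φ
      -- collapses each old vertex onto its root and maps walks of X to walks of D Q e.
      module Collapse (F-rooted : ∀ u → ∃ λ l → Reach F (l , fromℕ m) u) where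

        root : V₀ → Fin k
        root u = proj₁ (F-rooted u)

        φAt : Fin k → {b : Fin (suc (suc m))} → LastView b → K
        φAt a (old j) = root (a , j) , c0
        φAt a new = a , c1

        φ : V → K
        φ (a , b) = φAt a (lastView b)

        φ-up : ∀ u → φ (up u) ≡ (root u , c0)
        φ-up (a , j) rewrite lastView-old j = refl

        φ-new : ∀ a → φ (a , newCol) ≡ (a , c1)
        φ-new a rewrite lastView-new (suc m) = refl

        root-Q : ∀ {u w} → Reach F u w → Q (root u) (root w) ≡ true
        root-Q {u} {w} r = Q-sound _ _ (proj₂ (F-rooted u) ◅◅ (r ◅◅ F-rev (proj₂ (F-rooted w))))

        root-last : ∀ a → Q (root (a , fromℕ m)) a ≡ true
        root-last a = Q-sound _ _ (proj₂ (F-rooted (a , fromℕ m)))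

        -- an F-step stays inside a block (a clique step), a rung goes from the root of the
        -- last-column vertex to the new column
        φ-step : ∀ ex → Admissible ex → ∀ {u w} → StepV ex u w → Star (StepK ex) (φ u) (φ w)
        φ-step ex ok {a , b} {a' , b'} (h , nex) with lastView b | lastView b'
        ... | old j | old j' = Star.return (clique-step ex ok (root-Q (Star.return h)))
        ... | old j | new with ∧-elim {isLast j} h
        ... | last , rung-e with isLast⇒≡ {j} last
        ... | refl = clique-step ex ok (root-last a) ◅
                     Star.return (e-step ex rung-e (λ x → nex (excludedK⇒V ex x)))
        φ-step ex ok {a , b} {a' , b'} (h , nex) | new | old j with ∧-elim {isLast j} h
        ... | last , rung-e with isLast⇒≡ {j} last
        ... | refl = e-step ex rung-e (λ x → nex (excludedK⇒V ex x)) ◅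
                     Star.return (clique-step ex ok (Q-sym (root-last a')))
        φ-step ex ok {a , b} {a' , b'} (h , nex) | new | new = Star.return (e-step ex h (λ x → nex (excludedK⇒V ex x)))

        to-φψ : ∀ ex → Admissible ex → ∀ p → Star (StepK ex) p (φ (ψ p))
        to-φψ ex ok (a , zero) = subst (Star (StepK ex) (a , zero)) (sym (φ-up (a , fromℕ m)))
                                   (Star.return (clique-step ex ok (Q-sym (root-last a))))
        to-φψ ex ok (a , suc zero) = subst (Star (StepK ex) (a , c1)) (sym (φ-new a)) ε

        from-φψ : ∀ ex → Admissible ex → ∀ p → Star (StepK ex) (φ (ψ p)) p
        from-φψ ex ok (a , zero) = subst (λ z → Star (StepK ex) z (a , zero)) (sym (φ-up (a , fromℕ m)))
                                     (Star.return (clique-step ex ok (root-last a)))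
        from-φψ ex ok (a , suc zero) = subst (λ z → Star (StepK ex) z (a , c1)) (sym (φ-new a)) ε

        ψ-walk⁻¹ : ∀ ex → Admissible ex → ∀ {p q} → Star (StepV ex) (ψ p) (ψ q) → Star (StepK ex) p q
        ψ-walk⁻¹ ex ok {p} {q} w = to-φψ ex ok p ◅◅ (kleisliStar φ (φ-step ex ok) w ◅◅ from-φψ ex ok q)

        newTree⇒D : ∀ {i j} → Reach X (i , newCol) (j , newCol) → Reach DQ (i , c1) (j , c1)
        newTree⇒D w = toReachK (ψ-walk⁻¹ nothing tt (fromReachV w))

        gadget-edge-acyclic : (∀ a b → e a b ≡ true → ¬ Star (W.Without DQ a b) b a) →
          ∀ {c d} → X c d ≡ true → ¬ BothOld c d → ¬ Star (W.Without X c d) d c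
        gadget-edge-acyclic e-acyclic cd nb w with gadget-edge cd nb
        ... | a , b , ab , refl , refl =
          e-acyclic a b ab (toWithoutK {a} {b} (ψ-walk⁻¹ (just (a , b)) ab (fromWithoutV {a} {b} w)))

        -- X is acyclic: by cycle exchange, a cycle through an old edge either stays in
        -- the old columns (a cycle of F) or passes through an edge of e
        acyclic-glued : (∀ a b → e a b ≡ true → ¬ Star (W.Without DQ a b) b a) → W.Acyclic F → W.Acyclic X
        acyclic-glued e-acyclic F-acyclic u w uw walk with bothOld? u w
        ... | no nb = gadget-edge-acyclic e-acyclic uw nb walk
        ... | yes bo with W.CycleExchange.exchange X (λ x y → ¬? (bothOld? x y)) (λ n b → n (proj₂ b , proj₁ b))
                            u w uw (λ n → n bo) (W.steps walk) walk ℕP.≤-refl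
        ... | inj₂ (c , d , nb , cd , w') = gadget-edge-acyclic e-acyclic cd nb w'
        ... | inj₁ t = F-acyclic (lower u) (lower w) (trans (sym (X-old u w bo)) uw)
                         (kleisliStar lower (λ {x} {y} (wo , nn) → Star.return (lowerStep wo (¬¬bothOld {x} {y} nn))) t)
          where
          lower-injective : ∀ p q → IsOld p → IsOld q → lower p ≡ lower q → p ≡ q
          lower-injective p q op oq r = trans (sym (up-lower p op)) (trans (cong up r) (up-lower q oq))
          lowerStep : ∀ {x y} → W.Without X u w x y → BothOld x y → W.Without F (lower u) (lower w) (lower x) (lower y)
          lowerStep {x} {y} (xy , n₁ , n₂) bxy = trans (sym (X-old x y bxy)) xy ,
            (λ (p , q) → n₁ (lower-injective x u (proj₁ bxy) (proj₁ bo) p , lower-injective y w (proj₂ bxy) (proj₂ bo) q)) ,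
            (λ (p , q) → n₂ (lower-injective x w (proj₁ bxy) (proj₂ bo) p , lower-injective y u (proj₂ bxy) (proj₁ bo) q))

        rooted-glued : (∀ l → ∃ λ j → Reach DQ (l , c0) (j , c1)) → ∀ v → ∃ λ i → Reach X (i , newCol) v
        rooted-glued reaches (a , b) with lastView b
        ... | new = a , ε
        ... | old j with F-rooted (a , j) | reaches (root (a , j))
        ... | l , r | i , rd = i , (reach-sym X-sym (toReachV (ψ-walk nothing tt (fromReachK rd))) ◅◅
                                   toReachV (up-walk nothing tt r))

        reachesNew-from : (∀ v → ∃ λ i → Reach X (i , newCol) v) → ∀ l → ∃ λ j → Reach DQ (l , c0) (j , c1)
        reachesNew-from X-rooted l with X-rooted (ψ (l , c0))
        ... | i , r = i , reach-sym DQ-sym (toReachK (ψ-walk⁻¹ nothing tt {i , c1} {l , c0} (fromReachV r)))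
          where
          Q-symmetric : ∀ a a' → Q a a' ≡ Q a' a
          Q-symmetric a a' with Q a a' in eq₁ | Q a' a in eq₂
          ... | true | true = refl
          ... | false | false = refl
          ... | true | false = ⊥-elim (true≢false (trans (sym (Q-sym eq₁)) eq₂))
          ... | false | true = ⊥-elim (true≢false (trans (sym (Q-sym eq₂)) eq₁))
          DQ-sym : ∀ p q → DQ p q ≡ DQ q p
          DQ-sym (a , zero) (a' , zero) = cong₂ _∨_ (Q-symmetric a a') (e-sym _ _)
          DQ-sym (a , zero) (a' , suc zero) = e-sym _ _
          DQ-sym (a , suc zero) (a' , zero) = e-sym _ _
          DQ-sym (a , suc zero) (a' , suc zero) = e-sym _ _

    glue-consistent : ∀ {F e Q P} → Consistent m Q F → Valid Q P e → Consistent (suc m) P (glue F e)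
    glue-consistent {F} {e} {Q} {P} cF v = record
      { subgraph = X-sub
      ; acyclic = acyclic-glued acyclic (Consistent.acyclic cF)
      ; rooted = rooted-glued reachesNew
      ; sameTree⇒P = λ i j r → newTree⇒P i j (newTree⇒D r)
      ; P⇒sameTree = λ i j p → toReachV (ψ-walk nothing tt (fromReachK (P⇒newTree i j p))) }
      where
      open Valid v
      open Comparison F e Q (Consistent.subgraph cF) (Consistent.sameTree⇒P cF) (Consistent.P⇒sameTree cF)
                      onlyAllowed symmetric
      open Collapse (Consistent.rooted cF)

    split-consistent : ∀ {S P} → Consistent (suc m) P S → (Q : Part k) →
      (∀ a b → Reach (oldPart S) (a , fromℕ m) (b , fromℕ m) → Q a b ≡ true) →
      (∀ a b → Q a b ≡ true → Reach (oldPart S) (a , fromℕ m) (b , fromℕ m)) →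
      Consistent m Q (oldPart S) × Valid Q P (gadgetPart S)
    split-consistent {S} {P} cS Q Q-sound Q-complete =
      record { subgraph = F-sub ; acyclic = acyclic-old (Consistent.acyclic cX) ; rooted = F-rooted
             ; sameTree⇒P = Q-sound ; P⇒sameTree = Q-complete } ,
      record { onlyAllowed = e-allowed ; symmetric = e-sym ; acyclic = acyclic-gadget (Consistent.acyclic cX)
             ; reachesNew = reachesNew-from (Consistent.rooted cX)
             ; newTree⇒P = λ i j r → Consistent.sameTree⇒P cX i j (toReachV (ψ-walk nothing tt (fromReachK r)))
             ; P⇒newTree = λ i j p → newTree⇒D (Consistent.P⇒sameTree cX i j p) }
      where
      S-sub = Consistent.subgraph cS
      F-sub : IsEdgeSubset G (suc m) (oldPart S)
      F-sub = (λ u w h → adj-down (proj₁ S-sub _ _ h)) , (λ u w → proj₂ S-sub (up u) (up w))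
      e-allowed : ∀ p q → gadgetPart S p q ≡ true → allowed p q ≡ true
      e-allowed p q h = proj₁ (∧-elim {allowed p q} h)
      e-sym : ∀ p q → gadgetPart S p q ≡ gadgetPart S q p
      e-sym p q = cong₂ _∧_ (allowed-sym p q) (proj₂ S-sub (ψ p) (ψ q))
      open Comparison (oldPart S) (gadgetPart S) Q F-sub Q-sound Q-complete e-allowed e-sym
      cX : Consistent (suc m) P X
      cX = consistent-resp (≈E.sym (glue-parts S S-sub)) cS
      F-rooted = rooted-old (Consistent.rooted cX)
      open Collapse F-rooted

    glue-resp : ∀ {F F' e e'} → F ≈E F' → e ≈E e' → glue F e ≈E glue F' e'
    glue-resp F≈ e≈ (a , b) (a' , b') with lastView b | lastView b'
    ... | old j | old j' = F≈ _ _
    ... | old j | new = cong (isLast j ∧_) (e≈ _ _)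
    ... | new | old j = cong (isLast j ∧_) (e≈ _ _)
    ... | new | new = e≈ _ _

    oldPart-resp : ∀ {S S'} → S ≈E S' → oldPart S ≈E oldPart S'
    oldPart-resp S≈ u w = S≈ _ _

    gadgetPart-resp : ∀ {S S'} → S ≈E S' → gadgetPart S ≈E gadgetPart S'
    gadgetPart-resp S≈ p q = cong (allowed p q ∧_) (S≈ _ _)

-- The base case: a forest of G_1 consistent with P is the same as an edge set of the
-- gadget that is valid for (discrete , P).  Over the discrete partition every old vertex
-- of the gadget is isolated except for its rung, which validity therefore forces, so a
-- valid edge set is determined by its new column.

module Base (k : ℕ) (G : SimpleGraph k) where

  open Vertices k
  open Partitions k
  open Consistency k G
  open Gadget k G

  newColumn : EdgeSet k 2 → EdgeSet k 1
  newColumn e (a , _) (a' , _) = e (a , c1) (a' , c1)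

  withRungs : EdgeSet k 1 → EdgeSet k 2
  withRungs S (a , zero) (a' , zero) = false
  withRungs S (a , zero) (a' , suc zero) = eqB a a'
  withRungs S (a , suc zero) (a' , zero) = eqB a a'
  withRungs S (a , suc zero) (a' , suc zero) = S (a , zero) (a' , zero)

  toNew : Vtx k 1 → K
  toNew (a , _) = a , c1

  flatten : K → Vtx k 1
  flatten (a , _) = a , zero

  toNew-injective : ∀ {u w} → toNew u ≡ toNew w → u ≡ w
  toNew-injective {a , zero} {a' , zero} h = cong (_, zero) (cong proj₁ h)

  newColumn-withRungs : ∀ S → newColumn (withRungs S) ≈E S
  newColumn-withRungs S (a , zero) (a' , zero) = refl

  newColumn-resp : ∀ {e e'} → e ≈E e' → newColumn e ≈E newColumn e'
  newColumn-resp e≈ (a , _) (a' , _) = e≈ _ _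

  withRungs-resp : ∀ {S S'} → S ≈E S' → withRungs S ≈E withRungs S'
  withRungs-resp S≈ (a , zero) (a' , zero) = refl
  withRungs-resp S≈ (a , zero) (a' , suc zero) = refl
  withRungs-resp S≈ (a , suc zero) (a' , zero) = refl
  withRungs-resp S≈ (a , suc zero) (a' , suc zero) = S≈ _ _

  ∨-false : ∀ {b} → (b ∨ false) ≡ true → b ≡ true
  ∨-false {b} h = trans (sym (BP.∨-identityʳ b)) h

  module _ {P : Part k} {e : EdgeSet k 2} (v : Valid discrete P e) where
    open Valid v

    flatten-valid-step : ∀ {p q} → D discrete e p q ≡ true → Reach (newColumn e) (flatten p) (flatten q)
    flatten-valid-step {a , zero} {a' , zero} h with eqB a a' in eq
    ... | true with eqB⇒≡ {a} {a'} eq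
    ... | refl = ε
    flatten-valid-step {a , zero} {a' , zero} h | false = ⊥-elim (true≢false (sym (onlyAllowed _ _ h)))
    flatten-valid-step {a , zero} {a' , suc zero} h with eqB⇒≡ {a} {a'} (onlyAllowed _ _ h)
    ... | refl = ε
    flatten-valid-step {a , suc zero} {a' , zero} h with eqB⇒≡ {a} {a'} (onlyAllowed _ _ h)
    ... | refl = ε
    flatten-valid-step {a , suc zero} {a' , suc zero} h = Star.return h

    -- the old vertex a can only leave the old column by its own rung
    rung-forced : ∀ a {q} → Reach (D discrete e) (a , c0) q → proj₂ q ≡ c1 → e (a , c0) (a , c1) ≡ true
    rung-forced a ε ()
    rung-forced a (_◅_ {j = (x , zero)} h s) qc with eqB a x in eq
    ... | true with eqB⇒≡ {a} {x} eq
    ... | refl = rung-forced a s qc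
    rung-forced a (_◅_ {j = (x , zero)} h s) qc | false = ⊥-elim (true≢false (sym (onlyAllowed _ _ h)))
    rung-forced a (_◅_ {j = (x , suc zero)} h s) qc with eqB⇒≡ {a} {x} (onlyAllowed _ _ h)
    ... | refl = h

    newColumn-consistent : Consistent 0 P (newColumn e)
    newColumn-consistent = record
      { subgraph = (λ { (a , zero) (a' , zero) h → inj₂ (refl , onlyAllowed _ _ h) })
                 , (λ { (a , zero) (a' , zero) → symmetric _ _ })
      ; acyclic = λ u w h walk → acyclic (toNew u) (toNew w) h (kleisliStar toNew (λ {x} {y} (h' , n₁ , n₂) →
            Star.return (h' , (λ (p , q) → n₁ (toNew-injective p , toNew-injective q))
                            , (λ (p , q) → n₂ (toNew-injective p , toNew-injective q)))) walk)
      ; rooted = λ { (a , zero) → a , ε }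
      ; sameTree⇒P = λ i j r → newTree⇒P i j (kleisliStar toNew (λ h → Star.return h) r)
      ; P⇒sameTree = λ i j p → kleisliStar flatten flatten-valid-step (P⇒newTree i j p) }

    withRungs-newColumn : withRungs (newColumn e) ≈E e
    withRungs-newColumn (a , zero) (a' , zero) with e (a , c0) (a' , c0) in eq
    ... | false = refl
    ... | true = ⊥-elim (true≢false (sym (onlyAllowed _ _ eq)))
    withRungs-newColumn (a , zero) (a' , suc zero) with a FP.≟ a'
    ... | yes refl = sym (rung-forced a (proj₂ (reachesNew a)) refl)
    ... | no a≢a' with e (a , c0) (a' , c1) in eq
    ... | false = refl
    ... | true = ⊥-elim (a≢a' (eqB⇒≡ {a} {a'} (onlyAllowed _ _ eq)))
    withRungs-newColumn (a , suc zero) (a' , zero) with a FP.≟ a'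
    ... | yes refl = sym (trans (symmetric _ _) (rung-forced a (proj₂ (reachesNew a)) refl))
    ... | no a≢a' with e (a , c1) (a' , c0) in eq
    ... | false = refl
    ... | true = ⊥-elim (a≢a' (eqB⇒≡ {a} {a'} (onlyAllowed _ _ eq)))
    withRungs-newColumn (a , suc zero) (a' , suc zero) = refl

  module _ {P : Part k} {S : EdgeSet k 1} (c : Consistent 0 P S) where
    open Consistent c

    Dr : EdgeSet k 2
    Dr = D discrete (withRungs S)

    rungs-allowed : ∀ p q → withRungs S p q ≡ true → allowed p q ≡ true
    rungs-allowed (a , zero) (a' , suc zero) h = h
    rungs-allowed (a , suc zero) (a' , zero) h = h
    rungs-allowed (a , suc zero) (a' , suc zero) h with proj₁ subgraph _ _ h
    ... | inj₁ (_ , inj₁ ())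
    ... | inj₁ (_ , inj₂ ())
    ... | inj₂ (_ , p) = p

    rungs-sym : ∀ p q → withRungs S p q ≡ withRungs S q p
    rungs-sym (a , zero) (a' , zero) = refl
    rungs-sym (a , zero) (a' , suc zero) = eqB-sym a a'
    rungs-sym (a , suc zero) (a' , zero) = eqB-sym a a'
    rungs-sym (a , suc zero) (a' , suc zero) = proj₂ subgraph _ _

    Dr-sym : ∀ p q → Dr p q ≡ Dr q p
    Dr-sym (a , zero) (a' , zero) = cong (_∨ false) (eqB-sym a a')
    Dr-sym (a , zero) (a' , suc zero) = rungs-sym (a , c0) (a' , c1)
    Dr-sym (a , suc zero) (a' , zero) = rungs-sym (a , c1) (a' , c0)
    Dr-sym (a , suc zero) (a' , suc zero) = rungs-sym (a , c1) (a' , c1)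

    flatten-rungs-step : ∀ {p q} → Dr p q ≡ true → Reach S (flatten p) (flatten q)
    flatten-rungs-step {a , zero} {a' , zero} h with eqB⇒≡ {a} {a'} (∨-false h)
    ... | refl = ε
    flatten-rungs-step {a , zero} {a' , suc zero} h with eqB⇒≡ {a} {a'} h
    ... | refl = ε
    flatten-rungs-step {a , suc zero} {a' , zero} h with eqB⇒≡ {a} {a'} h
    ... | refl = ε
    flatten-rungs-step {a , suc zero} {a' , suc zero} h = Star.return h

    flatten-without : ∀ {x y p q} → W.Without Dr (x , c1) (y , c1) p q →
      Star (W.Without S (x , zero) (y , zero)) (flatten p) (flatten q)
    flatten-without {x} {y} {a , zero} {a' , zero} (h , _) with eqB⇒≡ {a} {a'} (∨-false h)
    ... | refl = ε
    flatten-without {x} {y} {a , zero} {a' , suc zero} (h , _) with eqB⇒≡ {a} {a'} h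
    ... | refl = ε
    flatten-without {x} {y} {a , suc zero} {a' , zero} (h , _) with eqB⇒≡ {a} {a'} h
    ... | refl = ε
    flatten-without {x} {y} {a , suc zero} {a' , suc zero} (h , n₁ , n₂) =
      Star.return (h , (λ (p , q) → n₁ (cong (_, c1) (cong proj₁ p) , cong (_, c1) (cong proj₁ q)))
                     , (λ (p , q) → n₂ (cong (_, c1) (cong proj₁ p) , cong (_, c1) (cong proj₁ q))))

    rung-isolates : ∀ {x q} → Star (W.Without Dr (x , c0) (x , c1)) (x , c0) q → q ≡ (x , c0)
    rung-isolates ε = refl
    rung-isolates {x} (_◅_ {j = (a , zero)} (h , _) s) with eqB⇒≡ {x} {a} (∨-false h)
    ... | refl = rung-isolates s
    rung-isolates {x} (_◅_ {j = (a , suc zero)} (h , n₁ , _) s) with eqB⇒≡ {x} {a} h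
    ... | refl = ⊥-elim (n₁ (refl , refl))

    without-rev : ∀ {a b u v} → W.Without Dr a b u v → W.Without Dr a b v u
    without-rev {u = u} {v} (h , n₁ , n₂) = trans (Dr-sym v u) h , (λ (p , q) → n₂ (q , p)) , (λ (p , q) → n₁ (q , p))

    c1≢c0 : ¬ (c1 ≡ c0)
    c1≢c0 ()

    rungs-acyclic : ∀ a b → withRungs S a b ≡ true → ¬ Star (W.Without Dr a b) b a
    rungs-acyclic (x , zero) (y , suc zero) h w with eqB⇒≡ {x} {y} h
    ... | refl = c1≢c0 (cong proj₂ (rung-isolates (Star.reverse without-rev w)))
    rungs-acyclic (x , suc zero) (y , zero) h w with eqB⇒≡ {x} {y} h
    ... | refl = c1≢c0 (cong proj₂ (rung-isolates (Star.map (λ (h , n₁ , n₂) → h , n₂ , n₁) w)))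
    rungs-acyclic (x , suc zero) (y , suc zero) h w =
      acyclic (x , zero) (y , zero) h (kleisliStar flatten flatten-without w)

    withRungs-valid : Valid discrete P (withRungs S)
    withRungs-valid = record
      { onlyAllowed = rungs-allowed ; symmetric = rungs-sym ; acyclic = rungs-acyclic
      ; reachesNew = λ l → l , Star.return (eqB-refl l)
      ; newTree⇒P = λ i j r → sameTree⇒P i j (kleisliStar flatten (λ {p} {q} → flatten-rungs-step {p} {q}) r)
      ; P⇒newTree = λ i j p → kleisliStar toNew (λ { {a , zero} {a' , zero} h → Star.return h }) (P⇒sameTree i j p) }

module MatrixPowers where

  open Counting using (sumℕ)

  sumFin-cong : ∀ {n} {f g : Fin n → ℤ} → (∀ j → f j ≡ g j) → sumFin f ≡ sumFin g
  sumFin-cong {zero} h = refl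
  sumFin-cong {suc n} h = cong₂ _+ℤ_ (h zero) (sumFin-cong (λ j → h (suc j)))

  sumFin-ℕ : ∀ {n} (h : Fin n → ℕ) → sumFin (λ j → + h j) ≡ + sumℕ h
  sumFin-ℕ {zero} h = refl
  sumFin-ℕ {suc n} h = cong (+ h zero +ℤ_) (sumFin-ℕ (λ j → h (suc j)))

  unit : ∀ {n} → Fin n → Fin n → ℤ
  unit zero zero = + 1
  unit zero (suc _) = + 0
  unit (suc _) zero = + 0
  unit (suc i) (suc j) = unit i j

  sumFin-zero : ∀ {n} → sumFin {n} (λ _ → + 0) ≡ + 0
  sumFin-zero {zero} = refl
  sumFin-zero {suc n} = cong (+ 0 +ℤ_) (sumFin-zero {n})

  mulVec-unit : ∀ {n} (f : Fin n → ℤ) j → sumFin (λ i → f i *ℤ unit j i) ≡ f j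
  mulVec-unit {suc n} f zero =
    trans (cong₂ _+ℤ_ (ℤP.*-identityʳ (f zero)) (trans (sumFin-cong (λ i → ℤP.*-zeroʳ (f (suc i)))) (sumFin-zero {n})))
          (ℤP.+-identityʳ (f zero))
  mulVec-unit {suc n} f (suc j) = trans (cong₂ _+ℤ_ (ℤP.*-zeroʳ (f zero)) (mulVec-unit (λ i → f (suc i)) j)) (ℤP.+-identityˡ _)

  powVec-unit : ∀ {B} (A : Fin B → Fin B → ℕ) (d : Fin B) (c : ℕ → Fin B → ℕ) →
    (∀ i → c 0 i ≡ A i d) → (∀ m i → c (suc m) i ≡ sumℕ (λ j → A i j * c m j)) →
    ∀ m i → powVec (λ i j → + A i j) (suc m) (unit d) i ≡ + c m i
  powVec-unit A d c c₀ c-step zero i = trans (mulVec-unit (λ j → + A i j) d) (cong +_ (sym (c₀ i)))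
  powVec-unit A d c c₀ c-step (suc m) i = begin
    sumFin (λ j → + A i j *ℤ powVec (λ i j → + A i j) (suc m) (unit d) j)
      ≡⟨ sumFin-cong (λ j → trans (cong (+ A i j *ℤ_) (powVec-unit A d c c₀ c-step m j)) (sym (ℤP.pos-* (A i j) (c m j)))) ⟩
    sumFin (λ j → + (A i j * c m j))  ≡⟨ sumFin-ℕ (λ j → A i j * c m j) ⟩
    + sumℕ (λ j → A i j * c m j)      ≡⟨ cong +_ (sym (c-step m i)) ⟩
    + c (suc m) i                     ∎
    where open ≡-Reasoning

-- M[P][Q] counts the edge sets valid for (Q , P); c m P counts the
-- forests of G_{m+1} consistent with P.  The base case and the gluing bijection give
-- c 0 = M e_discrete and c (m+1) = M (c m), so c m = M^{m+1} e_discrete.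

module TransferMatrix (k' : ℕ) (G : SimpleGraph (suc k')) (b : ℕ) (ps : Fin (suc b) → Part (suc k'))
                      (enum : IsOrderedEnumeration ps) where

  open Counting
  open Vertices (suc k')
  open Partitions (suc k')
  open Consistency (suc k') G
  open Gadget (suc k') G
  open Gluing (suc k') G
  open Base (suc k') G
  open MatrixPowers

  k : ℕ
  k = suc k'

  B : ℕ
  B = suc b

  ps-partition : ∀ i → IsPartition (ps i)
  ps-partition = proj₁ enum

  ps-distinct : ∀ i j → ps i ≈P ps j → i ≡ j
  ps-distinct = proj₁ (proj₂ enum)

  ps-complete : ∀ (P : Part k) → IsPartition P → ∃ λ i → P ≈P ps i
  ps-complete = proj₁ (proj₂ (proj₂ enum))

  d : Fin B
  d = proj₁ (ps-complete discrete discrete-isPartition)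

  ps-d : ps d ≈P discrete
  ps-d a b = sym (proj₂ (ps-complete discrete discrete-isPartition) a b)

  M : Fin B → Fin B → ℕ
  M i j = proj₁ (count-valid (ps j) (ps i))

  count-M : ∀ i j → Count _≈E_ (Valid (ps j) (ps i)) (M i j)
  count-M i j = proj₂ (count-valid (ps j) (ps i))

  c : ℕ → Fin B → ℕ
  c zero i = M i d
  c (suc m) i = sumℕ (λ j → M i j * c m j)

  consistent-unique : ∀ {m j j'} {F F' : EdgeSet k (suc m)} → Consistent m (ps j) F → Consistent m (ps j') F' →
    F ≈E F' → j ≡ j'
  consistent-unique cF cF' F≈ = ps-distinct _ _ (λ a a' → bool-ext
    (λ h → Consistent.sameTree⇒P cF' a a' (reach-resp F≈ (Consistent.P⇒sameTree cF a a' h)))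
    (λ h → Consistent.sameTree⇒P cF a a' (reach-resp (≈E.sym F≈) (Consistent.P⇒sameTree cF' a a' h))))
    where
    bool-ext : ∀ {x y : Bool} → (x ≡ true → y ≡ true) → (y ≡ true → x ≡ true) → x ≡ y
    bool-ext {true} {true} _ _ = refl
    bool-ext {false} {false} _ _ = refl
    bool-ext {true} {false} f _ = sym (f refl)
    bool-ext {false} {true} _ g = g refl

  induced-partition : ∀ {m} (F : EdgeSet k (suc m)) → (∀ u v → F u v ≡ F v u) → ∃ λ j →
    (∀ a a' → Reach F (a , fromℕ m) (a' , fromℕ m) → ps j a a' ≡ true) ×
    (∀ a a' → ps j a a' ≡ true → Reach F (a , fromℕ m) (a' , fromℕ m))
  induced-partition {m} F F-sym = j , (λ a a' r → trans (sym (Q≈ a a')) (fromDec (r? a a') r))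
                                    , (λ a a' h → toDec (r? a a') (trans (Q≈ a a') h))
    where
    r? : ∀ a a' → Dec (Reach F (a , fromℕ m) (a' , fromℕ m))
    r? a a' = reach? F (a , fromℕ m) (a' , fromℕ m)
    toDec : ∀ {A : Set} (d : Dec A) → does d ≡ true → A
    toDec (yes a) _ = a
    fromDec : ∀ {A : Set} (d : Dec A) → A → does d ≡ true
    fromDec (yes a) _ = refl
    fromDec (no ¬a) a = ⊥-elim (¬a a)
    Q : Part k
    Q a a' = does (r? a a')
    Q-isPartition : IsPartition Q
    Q-isPartition = (λ a → fromDec (r? a a) ε)
      , (λ a a' h → fromDec (r? a' a) (reach-sym F-sym (toDec (r? a a') h)))
      , (λ a a' a'' h₁ h₂ → fromDec (r? a a'') (toDec (r? a a') h₁ ◅◅ toDec (r? a' a'') h₂))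
    j = proj₁ (ps-complete Q Q-isPartition)
    Q≈ = proj₂ (ps-complete Q Q-isPartition)

  count-base : ∀ i → Count _≈E_ (Consistent 0 (ps i)) (c 0 i)
  count-base i = count-map ≈E.trans (count-M i d) newColumn (λ _ _ → newColumn-resp)
    (λ e v → newColumn-consistent (to-discrete v))
    (λ e e' v v' h → ≈E.trans (≈E.sym (withRungs-newColumn (to-discrete v)))
                       (≈E.trans (withRungs-resp h) (withRungs-newColumn (to-discrete v'))))
    (λ S cS → withRungs S , valid-resp (λ a b → sym (ps-d a b)) (λ _ _ → refl) (withRungs-valid cS)
            , newColumn-withRungs S)
    where
    to-discrete : ∀ {e} → Valid (ps d) (ps i) e → Valid discrete (ps i) e
    to-discrete = valid-resp ps-d (λ _ _ → refl)

  PairEq : ∀ {n} → EdgeSet k n × EdgeSet k 2 → EdgeSet k n × EdgeSet k 2 → Set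
  PairEq x y = proj₁ x ≈E proj₁ y × proj₂ x ≈E proj₂ y

  PairEq-equiv : ∀ {n} → IsEquivalence (PairEq {n})
  PairEq-equiv = record { refl = ≈E.refl , ≈E.refl ; sym = λ (h₁ , h₂) → ≈E.sym h₁ , ≈E.sym h₂
                        ; trans = λ (h₁ , h₂) (h₃ , h₄) → ≈E.trans h₁ h₃ , ≈E.trans h₂ h₄ }

  Pieces : ∀ m → Fin B → EdgeSet k (suc m) × EdgeSet k 2 → Set
  Pieces m i (F , e) = ∃ λ j → Consistent m (ps j) F × Valid (ps j) (ps i) e

  count-pieces : ∀ m i → (∀ j → Count _≈E_ (Consistent m (ps j)) (c m j)) →
    Count PairEq (Pieces m i) (c (suc m) i)
  count-pieces m i count-m = count-∃ PairEq-equiv pieces-j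
    (λ j j' x y (cF , _) (cF' , _) (F≈ , _) → consistent-unique cF cF' F≈)
    where
    pieces-j : ∀ j → Count PairEq (λ x → Consistent m (ps j) (proj₁ x) × Valid (ps j) (ps i) (proj₂ x)) (M i j * c m j)
    pieces-j j = subst (Count PairEq _) (ℕP.*-comm (c m j) (M i j)) (count-× (count-m j) (count-M i j))

  count-step : ∀ m i → (∀ j → Count _≈E_ (Consistent m (ps j)) (c m j)) →
    Count _≈E_ (Consistent (suc m) (ps i)) (c (suc m) i)
  count-step m i count-m = count-map ≈E.trans (count-pieces m i count-m)
    (λ (F , e) → glue F e) (λ _ _ (F≈ , e≈) → glue-resp F≈ e≈)
    (λ _ (j , cF , v) → glue-consistent cF v) glue-injective split
    where
    open Step m
    glue-injective : ∀ x y → Pieces m i x → Pieces m i y → glue (proj₁ x) (proj₂ x) ≈E glue (proj₁ y) (proj₂ y) → PairEq x y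
    glue-injective (F , e) (F' , e') (_ , _ , v) (_ , _ , v') h =
      ≈E.trans (≈E.sym (oldPart-glue F e)) (≈E.trans (oldPart-resp h) (oldPart-glue F' e')) ,
      ≈E.trans (≈E.sym (gadgetPart-glue F e (Valid.onlyAllowed v)))
               (≈E.trans (gadgetPart-resp h) (gadgetPart-glue F' e' (Valid.onlyAllowed v')))
    split : ∀ S → Consistent (suc m) (ps i) S → ∃ λ x → Pieces m i x × glue (proj₁ x) (proj₂ x) ≈E S
    split S cS with induced-partition (oldPart S) (λ u w → proj₂ (Consistent.subgraph cS) (up u) (up w))
    ... | j , Q-sound , Q-complete =
      (oldPart S , gadgetPart S) , (j , split-consistent cS (ps j) Q-sound Q-complete) ,
      glue-parts S (Consistent.subgraph cS)

  count-consistent : ∀ m i → Count _≈E_ (Consistent m (ps i)) (c m i)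
  count-consistent zero i = count-base i
  count-consistent (suc m) i = count-step m i (count-consistent m)

  count-ConsistentWith : ∀ m i → Count _≈E_ (ConsistentWith G m (ps i)) (c m i)
  count-ConsistentWith m i = count-cong (count-consistent m i)
    (λ S → consistent⇒ConsistentWith (ps-partition i)) (λ S → ConsistentWith⇒consistent (ps-partition i))

  -- spanning trees are the forests consistent with the first, one-block, partition
  count-trees : ∀ m → Count _≈E_ (IsSpanningTree G (suc m)) (c m zero)
  count-trees m = count-cong (count-consistent m zero) tree untree
    where
    one-block : ∀ a a' → ps zero a a' ≡ true
    one-block = FirstPartition.first-is-oneBlock k' enum
    tree : ∀ S → Consistent m (ps zero) S → IsSpanningTree G (suc m) S
    tree S cS = proj₁ (consistent⇒ConsistentWith (ps-partition zero) cS) , λ u v →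
      reach-sym (proj₂ subgraph) (proj₂ (rooted u)) ◅◅ (P⇒sameTree _ _ (one-block _ _) ◅◅ proj₂ (rooted v))
      where open Consistent cS
    untree : ∀ S → IsSpanningTree G (suc m) S → Consistent m (ps zero) S
    untree S ((sub , noCycle) , connected) = record
      { subgraph = sub ; acyclic = proj₁ (noCycle⇔acyclic sub) noCycle ; rooted = λ v → zero , connected _ v
      ; sameTree⇒P = λ a a' _ → one-block a a' ; P⇒sameTree = λ a a' _ → connected _ _ }

  powers : ∀ m i → powVec (λ i j → + M i j) (suc m) (unit d) i ≡ + c m i
  powers = powVec-unit M d c (λ _ → refl) (λ _ _ → refl)

theorem1 : (k : ℕ) → 1 ≤ k → (G : SimpleGraph k) →
    (b : ℕ) (ps : Fin (suc b) → Part k) → IsOrderedEnumeration ps →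
    ∃ λ (M : Fin (suc b) → Fin (suc b) → ℤ) → ∃ λ (v : Fin (suc b) → ℤ) → ∀ (m : ℕ) →
      (∃[ N ] (Count _≈E_ (IsSpanningTree G (suc m)) N × powVec M (suc m) v zero ≡ + N)) ×
      (∀ (i : Fin (suc b)) →
        ∃[ N ] (Count _≈E_ (ConsistentWith G m (ps i)) N × powVec M (suc m) v i ≡ + N))
theorem1 (suc k') _ G b ps enum =
  (λ i j → + M i j) , unit d , λ m →
    (c m zero , count-trees m , powers m zero) , λ i → c m i , count-ConsistentWith m i , powers m i
  where
  open TransferMatrix k' G b ps enum
  open MatrixPowers using (unit)
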